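{- If there exists an $\mathrm{SCCD}(v,k,b)$ with excess $e$ and an $\mathrm{SCCD}(v',k,b')$ with an outer expansion set and excess $e'$, then an $\mathrm{SCCD}(v^*,k,b^*)$ with $v^*=v+v'-k+1$ and $b^*=b+b'+\frac{(v-k+1)(v'-k+1)}{k-1}$ exists with excess $e^*=e+e'$. Furthermore, if the $\mathrm{SCCD}(v,k,b)$ has an expansion set, then the $\mathrm{SCCD}(v^*,k,b^*)$ has an expansion set.
   Context: An $\mathrm{SCCD}(v,k,b)$ (linear single change covering design) is a $v$-set $X$ with an ordered list $(B_1,\dots,B_b)$ of $k$-subsets of $X$ with $|B_i\cap B_{i+1}|=k-1$ for $1\le i<b$, such that every pair of elements of $X$ is contained in some block. Its excess is $e=(k-1)b+\binom{k-1}{2}-\binom{v}{2}$. The unchanged subsets are $U_i=B_i\cap B_{i+1}$ for $1\le i\le b-1$; in addition $U_0$ may be taken to be any $(k-1)$-subset of $B_1$ and $U_b$ any $(k-1)$-subset of $B_b$. An expansion set is a collection of $\frac{v}{k-1}$ unchanged subsets $U_{i_1},\dots,U_{i_{v/(k-1)}}$ (with distinct indices $i_j\in\{0,\dots,b\}$) that are pairwise disjoint and whose union is $X$. It is an outer expansion set if it contains $U_0$ or $U_b$ (or both), and an inner expansion set otherwise. -}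

module Defs where

open import Data.Nat using (ℕ; zero; suc; _+_; _*_; _∸_; _≤_)
open import Data.Nat.Combinatorics using (_C_)
open import Data.Integer as ℤ using (ℤ; +_)
open import Data.Fin using (Fin; toℕ)
open import Data.Fin.Subset using (Subset; _∈_; _⊆_; _∩_; ∣_∣; Empty)
open import Data.Product using (Σ; ∃; ∃-syntax; _×_; _,_; proj₁; proj₂)
open import Data.Sum using (_⊎_)
open import Data.List using (List; length; map)
open import Data.List.Relation.Unary.All using (All)
open import Data.List.Relation.Unary.Any using (Any)
open import Data.List.Relation.Unary.AllPairs using (AllPairs)
open import Data.List.Relation.Unary.Unique.Propositional using (Unique)
open import Relation.Binary.PropositionalEquality using (_≡_; _≢_)

-- Linear single change covering design SCCD(v,k,b) on the point set X = Fin v.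
-- Blocks B_1..B_b are stored 0-based: block (j : Fin b) is B_{toℕ j + 1}.
record SCCD (v k b : ℕ) : Set where
  field
    block       : Fin b → Subset v
    blockSize   : ∀ j → ∣ block j ∣ ≡ k
    singleChange : ∀ (i j : Fin b) → toℕ j ≡ suc (toℕ i) →
                   ∣ block i ∩ block j ∣ ≡ k ∸ 1
    covers      : ∀ (x y : Fin v) → x ≢ y →
                  ∃[ j ] (x ∈ block j × y ∈ block j)

open SCCD public

excess : ℕ → ℕ → ℕ → ℤ
excess v k b = (+ ((k ∸ 1) * b + ((k ∸ 1) C 2))) ℤ.- (+ (v C 2))

-- U is a legitimate choice of the unchanged subset U_i (i ∈ {0,…,b}):
--  * U_0 : any (k-1)-subset of B_1
--  * U_b : any (k-1)-subset of B_b
--  * U_i = B_i ∩ B_{i+1} for 1 ≤ i ≤ b-1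
Unchanged : ∀ {v k b} → SCCD v k b → ℕ → Subset v → Set
Unchanged {v} {k} {b} D i U =
    (i ≡ 0 × Σ (Fin b) λ j → toℕ j ≡ 0 × U ⊆ block D j × ∣ U ∣ ≡ k ∸ 1)
  ⊎ ((i ≡ b × Σ (Fin b) λ j → suc (toℕ j) ≡ b × U ⊆ block D j × ∣ U ∣ ≡ k ∸ 1)
  ⊎ (Σ (Fin b) λ j → Σ (Fin b) λ j' → toℕ j' ≡ suc (toℕ j) × i ≡ toℕ j'
        × U ≡ (block D j ∩ block D j')))

record IsExpansionSet {v k b} (D : SCCD v k b) (L : List (ℕ × Subset v)) : Set where
  field
    unchanged : All (λ p → Unchanged D (proj₁ p) (proj₂ p)) L
    distinct  : Unique (map proj₁ L)
    count     : length L * (k ∸ 1) ≡ v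
    disjoint  : AllPairs (λ p q → Empty (proj₂ p ∩ proj₂ q)) L
    cover     : ∀ (x : Fin v) → Any (λ p → x ∈ proj₂ p) L

ExpansionSet : ∀ {v k b} → SCCD v k b → Set
ExpansionSet {v} D = Σ (List (ℕ × Subset v)) λ L → IsExpansionSet D L

OuterExpansionSet : ∀ {v k b} → SCCD v k b → Set
OuterExpansionSet {v} {k} {b} D =
  Σ (List (ℕ × Subset v)) λ L → IsExpansionSet D L
    × Any (λ p → proj₁ p ≡ 0 ⊎ proj₁ p ≡ b) L

{-# OPTIONS --safe #-}
-- Put U'_0 of the outer expansion set of the second design first (reversing its blocks if the set
-- contains U'_b' instead), and identify U'_0 with a (k-1)-subset G of the last block of the first
-- design (its U_b if it has an expansion set using U_b). The second design then contributes
-- v' - k + 1 new points, and listing the blocks of the first design followed by those of the second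
-- gives a single change sequence covering every pair except an old point outside G with a new point.
-- Each other member S of the outer expansion set is B'_t ∩ B'_(t+1) (or lies in the last block B'_t);
-- inserting after B'_t the blocks S ∪ {x}, for the v - k + 1 old points x outside G, keeps single
-- changes (consecutive ones meet in S) and covers those pairs, since such S partition the new points.
-- This costs (v - k + 1)(v' - k + 1)/(k - 1) blocks and adds the excesses. The expansion set of the
-- first design together with the images of these S is an expansion set of the result.
module Submission where

open import Defs
open import Data.Nat using (ℕ; zero; suc; _+_; _*_; _∸_; _≤_; _<_; z≤n; s≤s; >-nonZero)
open import Data.Nat.Properties
open import Data.Nat.Combinatorics using (_C_; nC1≡n; nCk+nC[k+1]≡[n+1]C[k+1])
open import Data.Nat.Tactic.RingSolver using (solve-∀)
import Data.Integer as ℤ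
import Data.Integer.Properties as ℤ
import Data.Integer.Tactic.RingSolver as ℤ-Solver
open import Data.Fin as Fin using (Fin; zero; suc; toℕ; fromℕ<; _↑ˡ_; _↑ʳ_)
import Data.Fin.Properties as Fin
import Data.Bool.Properties as Bool
import Data.Vec.Properties as Vec
open import Data.Fin.Subset
open import Data.Fin.Subset.Properties
open import Data.Vec using ([]; _∷_; here; there)
open import Data.List as List using (List; []; _∷_; _++_; length; map)
import Data.List.Properties as List
open import Data.List.Relation.Unary.All as All using (All; []; _∷_)
import Data.List.Relation.Unary.All.Properties as All
open import Data.List.Relation.Unary.Any as Any using (Any; here; there)
import Data.List.Relation.Unary.Any.Properties as Any
open import Data.List.Relation.Unary.AllPairs as AllPairs using (AllPairs; []; _∷_)
import Data.List.Relation.Unary.AllPairs.Properties as AllPairs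
open import Data.List.Relation.Unary.Linked using (Linked; []; [-]; _∷_; _∷′_)
open import Data.List.Relation.Unary.Unique.Propositional using (Unique)
import Data.List.Relation.Unary.Unique.Propositional.Properties as Unique
open import Data.List.Membership.Propositional using (find; lose) renaming (_∈_ to _∈ˡ_; _∉_ to _∉ˡ_)
open import Data.List.Membership.Propositional.Properties
open import Data.Maybe using (Maybe; just; nothing)
open import Data.Maybe.Relation.Binary.Connected using (Connected; just; just-nothing)
open import Data.Product using (Σ; ∃; ∃-syntax; _×_; _,_; proj₁; proj₂)
open import Data.Sum using (_⊎_; inj₁; inj₂)
open import Data.Empty using (⊥-elim)
open import Function using (_∘_)
open import Function.Definitions using (Injective)
open import Relation.Nullary using (Dec; yes; no)
open import Relation.Nullary.Decidable using (_×-dec_; _⊎-dec_; ¬?; map′)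
open import Relation.Binary.Definitions using (tri<; tri≈; tri>)
open import Relation.Binary.PropositionalEquality
  using (_≡_; _≢_; refl; sym; trans; cong; cong₂; subst; subst₂; module ≡-Reasoning)

private
  variable
    n : ℕ

-- Subsets of Fin n

module _ {p q : Subset n} {x : Fin n} where
  x∈p∧x∈q⇒x∈p∩q : x ∈ p → x ∈ q → x ∈ p ∩ q
  x∈p∧x∈q⇒x∈p∩q x∈p x∈q = x∈p∩q⁺ (x∈p , x∈q)

  x∈p∩q⇒x∈p : x ∈ p ∩ q → x ∈ p
  x∈p∩q⇒x∈p = proj₁ ∘ x∈p∩q⁻ p q

  x∈p∩q⇒x∈q : x ∈ p ∩ q → x ∈ q
  x∈p∩q⇒x∈q = proj₂ ∘ x∈p∩q⁻ p q

  x∈p⇒x∈p∪q : x ∈ p → x ∈ p ∪ q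
  x∈p⇒x∈p∪q = x∈p∪q⁺ ∘ inj₁

  x∈q⇒x∈p∪q : x ∈ q → x ∈ p ∪ q
  x∈q⇒x∈p∪q = x∈p∪q⁺ ∘ inj₂

∣p∪q∣+∣p∩q∣≡∣p∣+∣q∣ : (p q : Subset n) → ∣ p ∪ q ∣ + ∣ p ∩ q ∣ ≡ ∣ p ∣ + ∣ q ∣
∣p∪q∣+∣p∩q∣≡∣p∣+∣q∣ [] [] = refl
∣p∪q∣+∣p∩q∣≡∣p∣+∣q∣ (inside ∷ p) (inside ∷ q) = cong suc (begin
  ∣ p ∪ q ∣ + suc ∣ p ∩ q ∣   ≡⟨ +-suc ∣ p ∪ q ∣ ∣ p ∩ q ∣ ⟩
  suc (∣ p ∪ q ∣ + ∣ p ∩ q ∣) ≡⟨ cong suc (∣p∪q∣+∣p∩q∣≡∣p∣+∣q∣ p q) ⟩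
  suc (∣ p ∣ + ∣ q ∣)         ≡⟨ +-suc ∣ p ∣ ∣ q ∣ ⟨
  ∣ p ∣ + suc ∣ q ∣           ∎)
  where open ≡-Reasoning
∣p∪q∣+∣p∩q∣≡∣p∣+∣q∣ (inside ∷ p) (outside ∷ q) = cong suc (∣p∪q∣+∣p∩q∣≡∣p∣+∣q∣ p q)
∣p∪q∣+∣p∩q∣≡∣p∣+∣q∣ (outside ∷ p) (inside ∷ q) =
  trans (cong suc (∣p∪q∣+∣p∩q∣≡∣p∣+∣q∣ p q)) (sym (+-suc ∣ p ∣ ∣ q ∣))
∣p∪q∣+∣p∩q∣≡∣p∣+∣q∣ (outside ∷ p) (outside ∷ q) = ∣p∪q∣+∣p∩q∣≡∣p∣+∣q∣ p q

Empty[p∩q]⇒∣p∪q∣≡∣p∣+∣q∣ : (p q : Subset n) → Empty (p ∩ q) → ∣ p ∪ q ∣ ≡ ∣ p ∣ + ∣ q ∣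
Empty[p∩q]⇒∣p∪q∣≡∣p∣+∣q∣ {n} p q empty = begin
  ∣ p ∪ q ∣                 ≡⟨ +-identityʳ _ ⟨
  ∣ p ∪ q ∣ + 0             ≡⟨ cong (∣ p ∪ q ∣ +_) (∣⊥∣≡0 n) ⟨
  ∣ p ∪ q ∣ + ∣ ⊥ {n} ∣     ≡⟨ cong (λ r → ∣ p ∪ q ∣ + ∣ r ∣) (Empty-unique empty) ⟨
  ∣ p ∪ q ∣ + ∣ p ∩ q ∣     ≡⟨ ∣p∪q∣+∣p∩q∣≡∣p∣+∣q∣ p q ⟩
  ∣ p ∣ + ∣ q ∣             ∎
  where open ≡-Reasoning

Empty-∩-comm : {p q : Subset n} → Empty (p ∩ q) → Empty (q ∩ p)
Empty-∩-comm {p = p} {q} empty (x , x∈q∩p) = empty (x , subst (x ∈_) (∩-comm q p) x∈q∩p)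

x∉p⇒∣p∪⁅x⁆∣≡1+∣p∣ : (p : Subset n) (x : Fin n) → x ∉ p → ∣ p ∪ ⁅ x ⁆ ∣ ≡ suc ∣ p ∣
x∉p⇒∣p∪⁅x⁆∣≡1+∣p∣ p x x∉p = begin
  ∣ p ∪ ⁅ x ⁆ ∣      ≡⟨ Empty[p∩q]⇒∣p∪q∣≡∣p∣+∣q∣ p ⁅ x ⁆ disjoint ⟩
  ∣ p ∣ + ∣ ⁅ x ⁆ ∣  ≡⟨ cong (∣ p ∣ +_) (∣⁅x⁆∣≡1 x) ⟩
  ∣ p ∣ + 1          ≡⟨ +-comm ∣ p ∣ 1 ⟩
  suc ∣ p ∣          ∎
  where
  open ≡-Reasoning
  disjoint : Empty (p ∩ ⁅ x ⁆)
  disjoint (y , y∈) = x∉p (subst (_∈ p) (x∈⁅y⁆⇒x≡y x (x∈p∩q⇒x∈q y∈)) (x∈p∩q⇒x∈p y∈))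

x∈p─q⇒x∉q : (p q : Subset n) {x : Fin n} → x ∈ p ─ q → x ∉ q
x∈p─q⇒x∉q (inside ∷ p) (inside ∷ q) (there x∈) (there x∈q) = x∈p─q⇒x∉q p q x∈ x∈q
x∈p─q⇒x∉q (outside ∷ p) (inside ∷ q) (there x∈) (there x∈q) = x∈p─q⇒x∉q p q x∈ x∈q
x∈p─q⇒x∉q (inside ∷ p) (outside ∷ q) (there x∈) (there x∈q) = x∈p─q⇒x∉q p q x∈ x∈q
x∈p─q⇒x∉q (outside ∷ p) (outside ∷ q) (there x∈) (there x∈q) = x∈p─q⇒x∉q p q x∈ x∈q

x∈p⇒∣p-x∣+1≡∣p∣ : (p : Subset n) (x : Fin n) → x ∈ p → suc ∣ p - x ∣ ≡ ∣ p ∣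
x∈p⇒∣p-x∣+1≡∣p∣ p x x∈p = begin
  suc ∣ p - x ∣        ≡⟨ x∉p⇒∣p∪⁅x⁆∣≡1+∣p∣ (p - x) x (λ x∈ → x∉⁅y⁆⇒x≢y (x∈p─q⇒x∉q p ⁅ x ⁆ x∈) refl) ⟨
  ∣ (p - x) ∪ ⁅ x ⁆ ∣  ≡⟨ cong ∣_∣ (⊆-antisym ⊆p ⊇p) ⟩
  ∣ p ∣                ∎
  where
  open ≡-Reasoning
  ⊆p : (p - x) ∪ ⁅ x ⁆ ⊆ p
  ⊆p y∈ with x∈p∪q⁻ (p - x) ⁅ x ⁆ y∈
  ... | inj₁ y∈p-x = p─q⊆p p ⁅ x ⁆ y∈p-x
  ... | inj₂ y∈⁅x⁆ = subst (_∈ p) (sym (x∈⁅y⁆⇒x≡y x y∈⁅x⁆)) x∈p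
  ⊇p : p ⊆ (p - x) ∪ ⁅ x ⁆
  ⊇p {y} y∈p with y Fin.≟ x
  ... | yes refl = x∈q⇒x∈p∪q (x∈⁅x⁆ x)
  ... | no y≢x   = x∈p⇒x∈p∪q (x∈p∧x≢y⇒x∈p-y y∈p y≢x)

∪⁅x⁆∩-cancel : (p q : Subset n) (x : Fin n) → p ⊆ q → x ∉ q → (p ∪ ⁅ x ⁆) ∩ q ≡ p
∪⁅x⁆∩-cancel p q x p⊆q x∉q = ⊆-antisym ⊆p (λ y∈p → x∈p∧x∈q⇒x∈p∩q (x∈p⇒x∈p∪q y∈p) (p⊆q y∈p))
  where
  ⊆p : (p ∪ ⁅ x ⁆) ∩ q ⊆ p
  ⊆p y∈ with x∈p∪q⁻ p ⁅ x ⁆ (x∈p∩q⇒x∈p y∈)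
  ... | inj₁ y∈p = y∈p
  ... | inj₂ y∈⁅x⁆ = ⊥-elim (x∉q (subst (_∈ q) (x∈⁅y⁆⇒x≡y x y∈⁅x⁆) (x∈p∩q⇒x∈q y∈)))

image : {m : ℕ} → (Fin n → Fin m) → Subset n → Subset m
image f []            = ⊥
image f (outside ∷ p) = image (f ∘ suc) p
image f (inside ∷ p)  = ⁅ f zero ⁆ ∪ image (f ∘ suc) p

module _ {m : ℕ} where
  ∈-image⁺ : (f : Fin n → Fin m) (p : Subset n) {x : Fin n} → x ∈ p → f x ∈ image f p
  ∈-image⁺ f (inside ∷ p) here = x∈p⇒x∈p∪q (x∈⁅x⁆ (f zero))
  ∈-image⁺ f (inside ∷ p) (there x∈p) = x∈q⇒x∈p∪q (∈-image⁺ (f ∘ suc) p x∈p)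
  ∈-image⁺ f (outside ∷ p) (there x∈p) = ∈-image⁺ (f ∘ suc) p x∈p

  ∈-image⁻ : (f : Fin n → Fin m) (p : Subset n) {z : Fin m} →
             z ∈ image f p → ∃[ x ] x ∈ p × f x ≡ z
  ∈-image⁻ f [] z∈ = ⊥-elim (∉⊥ z∈)
  ∈-image⁻ f (outside ∷ p) z∈ with ∈-image⁻ (f ∘ suc) p z∈
  ... | x , x∈p , refl = suc x , there x∈p , refl
  ∈-image⁻ f (inside ∷ p) z∈ with x∈p∪q⁻ ⁅ f zero ⁆ _ z∈
  ... | inj₁ z∈⁅f0⁆ = zero , here , sym (x∈⁅y⁆⇒x≡y _ z∈⁅f0⁆)
  ... | inj₂ z∈img with ∈-image⁻ (f ∘ suc) p z∈img
  ...   | x , x∈p , refl = suc x , there x∈p , refl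

  image-mono : (f : Fin n → Fin m) {p q : Subset n} → p ⊆ q → image f p ⊆ image f q
  image-mono f {p} {q} p⊆q z∈ with ∈-image⁻ f p z∈
  ... | x , x∈p , refl = ∈-image⁺ f q (p⊆q x∈p)

  ∣image∣ : {f : Fin n → Fin m} → Injective _≡_ _≡_ f → (p : Subset n) → ∣ image f p ∣ ≡ ∣ p ∣
  ∣image∣ f-inj [] = ∣⊥∣≡0 m
  ∣image∣ f-inj (outside ∷ p) = ∣image∣ (Fin.suc-injective ∘ f-inj) p
  ∣image∣ {f = f} f-inj (inside ∷ p) = begin
    ∣ ⁅ f zero ⁆ ∪ image (f ∘ suc) p ∣      ≡⟨ Empty[p∩q]⇒∣p∪q∣≡∣p∣+∣q∣ _ _ disjoint ⟩
    ∣ ⁅ f zero ⁆ ∣ + ∣ image (f ∘ suc) p ∣  ≡⟨ cong₂ _+_ (∣⁅x⁆∣≡1 (f zero)) (∣image∣ (Fin.suc-injective ∘ f-inj) p) ⟩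
    suc ∣ p ∣                               ∎
    where
    open ≡-Reasoning
    disjoint : Empty (⁅ f zero ⁆ ∩ image (f ∘ suc) p)
    disjoint (z , z∈) with ∈-image⁻ (f ∘ suc) p (x∈p∩q⇒x∈q z∈)
    ... | x , _ , fsx≡z with f-inj (trans fsx≡z (x∈⁅y⁆⇒x≡y _ (x∈p∩q⇒x∈p z∈)))
    ...   | ()

  module _ {f : Fin n → Fin m} (f-inj : Injective _≡_ _≡_ f) where
    image-∩ : (p q : Subset n) → image f (p ∩ q) ≡ image f p ∩ image f q
    image-∩ p q = ⊆-antisym
      (λ z∈ → x∈p∧x∈q⇒x∈p∩q (image-mono f (p∩q⊆p p q) z∈) (image-mono f (p∩q⊆q p q) z∈))
      ⊇∩
      where
      ⊇∩ : image f p ∩ image f q ⊆ image f (p ∩ q)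
      ⊇∩ z∈ with ∈-image⁻ f p (x∈p∩q⇒x∈p z∈) | ∈-image⁻ f q (x∈p∩q⇒x∈q z∈)
      ... | x , x∈p , refl | y , y∈q , fy≡fx with f-inj fy≡fx
      ...   | refl = ∈-image⁺ f (p ∩ q) (x∈p∧x∈q⇒x∈p∩q x∈p y∈q)

    ∣image-∩∣ : (p q : Subset n) → ∣ image f p ∩ image f q ∣ ≡ ∣ p ∩ q ∣
    ∣image-∩∣ p q = trans (cong ∣_∣ (sym (image-∩ p q))) (∣image∣ f-inj (p ∩ q))

    image-Empty : {p q : Subset n} → Empty (p ∩ q) → Empty (image f p ∩ image f q)
    image-Empty {p} {q} empty (z , z∈) with ∈-image⁻ f (p ∩ q) (subst (z ∈_) (sym (image-∩ p q)) z∈)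
    ... | x , x∈p∩q , _ = empty (x , x∈p∩q)

elements : Subset n → List (Fin n)
elements []            = []
elements (outside ∷ p) = map suc (elements p)
elements (inside ∷ p)  = zero ∷ map suc (elements p)

length-elements : (p : Subset n) → length (elements p) ≡ ∣ p ∣
length-elements [] = refl
length-elements (outside ∷ p) = trans (List.length-map suc (elements p)) (length-elements p)
length-elements (inside ∷ p) = cong suc (trans (List.length-map suc (elements p)) (length-elements p))

∈-elements⁺ : (p : Subset n) {x : Fin n} → x ∈ p → x ∈ˡ elements p
∈-elements⁺ (inside ∷ p) here = here refl
∈-elements⁺ (inside ∷ p) (there x∈p) = there (∈-map⁺ suc (∈-elements⁺ p x∈p))
∈-elements⁺ (outside ∷ p) (there x∈p) = ∈-map⁺ suc (∈-elements⁺ p x∈p)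

∈-elements⁻ : (p : Subset n) {x : Fin n} → x ∈ˡ elements p → x ∈ p
∈-elements⁻ (inside ∷ p) (here refl) = here
∈-elements⁻ (inside ∷ p) (there x∈) with ∈-map⁻ suc x∈
... | y , y∈ , refl = there (∈-elements⁻ p y∈)
∈-elements⁻ (outside ∷ p) x∈ with ∈-map⁻ suc x∈
... | y , y∈ , refl = there (∈-elements⁻ p y∈)

elements-unique : (p : Subset n) → Unique (elements p)
elements-unique [] = []
elements-unique (outside ∷ p) = Unique.map⁺ Fin.suc-injective (elements-unique p)
elements-unique (inside ∷ p) =
  All.tabulate (λ x∈ 0≡x → zero∉ 0≡x x∈) ∷ Unique.map⁺ Fin.suc-injective (elements-unique p)
  where
  zero∉ : ∀ {x} → zero ≡ x → x ∉ˡ map suc (elements p)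
  zero∉ refl x∈ with ∈-map⁻ suc x∈
  ... | _ , _ , ()

lookup-injective : {A : Set} {xs : List A} → Unique xs →
                   ∀ {i j} → List.lookup xs i ≡ List.lookup xs j → i ≡ j
lookup-injective (_ ∷ _) {zero} {zero} _ = refl
lookup-injective (x∉ ∷ _) {zero} {suc j} eq = ⊥-elim (All.lookup x∉ (∈-lookup j) eq)
lookup-injective (x∉ ∷ _) {suc i} {zero} eq = ⊥-elim (All.lookup x∉ (∈-lookup i) (sym eq))
lookup-injective (_ ∷ u) {suc i} {suc j} eq = cong suc (lookup-injective u eq)

cast-injective : {m : ℕ} (eq : m ≡ n) {i j : Fin m} → Fin.cast eq i ≡ Fin.cast eq j → i ≡ j
cast-injective eq {i} {j} cast≡ = begin
  i                                   ≡⟨ Fin.cast-involutive (sym eq) eq i ⟨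
  Fin.cast (sym eq) (Fin.cast eq i)   ≡⟨ cong (Fin.cast (sym eq)) cast≡ ⟩
  Fin.cast (sym eq) (Fin.cast eq j)   ≡⟨ Fin.cast-involutive (sym eq) eq j ⟩
  j                                   ∎
  where open ≡-Reasoning

index-unique : {A : Set} {xs : List A} → Unique xs →
               ∀ {x} (x∈ : x ∈ˡ xs) i → x ≡ List.lookup xs i → Any.index x∈ ≡ i
index-unique u x∈ i eq = lookup-injective u (trans (sym (Any.lookup-index x∈)) eq)

module Correspondence {A B : Set} {xs : List A} {ys : List B} (|xs|≡|ys| : length xs ≡ length ys)
                      (xs-unique : Unique xs) (ys-unique : Unique ys) where
  partner : ∀ {x} → x ∈ˡ xs → B
  partner x∈ = List.lookup ys (Fin.cast |xs|≡|ys| (Any.index x∈))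

  partner-∈ : ∀ {x} (x∈ : x ∈ˡ xs) → partner x∈ ∈ˡ ys
  partner-∈ x∈ = ∈-lookup _

  partner-irrelevant : ∀ {x} (x∈ x∈′ : x ∈ˡ xs) → partner x∈ ≡ partner x∈′
  partner-irrelevant x∈ x∈′ =
    cong (List.lookup ys ∘ Fin.cast |xs|≡|ys|)
         (index-unique xs-unique x∈ (Any.index x∈′) (Any.lookup-index x∈′))

  partner-injective : ∀ {x₁ x₂} (x₁∈ : x₁ ∈ˡ xs) (x₂∈ : x₂ ∈ˡ xs) → partner x₁∈ ≡ partner x₂∈ → x₁ ≡ x₂
  partner-injective x₁∈ x₂∈ eq = begin
    _                                ≡⟨ Any.lookup-index x₁∈ ⟩
    List.lookup xs (Any.index x₁∈)  ≡⟨ cong (List.lookup xs) (cast-injective |xs|≡|ys| (lookup-injective ys-unique eq)) ⟩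
    List.lookup xs (Any.index x₂∈)  ≡⟨ Any.lookup-index x₂∈ ⟨
    _                                ∎
    where open ≡-Reasoning

  partner-surjective : ∀ {y} → y ∈ˡ ys → ∃[ x ] Σ (x ∈ˡ xs) λ x∈ → partner x∈ ≡ y
  partner-surjective {y} y∈ = List.lookup xs i , ∈-lookup i , (begin
    List.lookup ys (Fin.cast |xs|≡|ys| (Any.index (∈-lookup {xs = xs} i)))
      ≡⟨ cong (List.lookup ys ∘ Fin.cast |xs|≡|ys|) (index-unique xs-unique (∈-lookup i) i refl) ⟩
    List.lookup ys (Fin.cast |xs|≡|ys| i)
      ≡⟨ cong (List.lookup ys) (Fin.cast-involutive |xs|≡|ys| (sym |xs|≡|ys|) (Any.index y∈)) ⟩
    List.lookup ys (Any.index y∈)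
      ≡⟨ Any.lookup-index y∈ ⟨
    y ∎)
    where
    open ≡-Reasoning
    i = Fin.cast (sym |xs|≡|ys|) (Any.index y∈)

↑ˡ≢↑ʳ : {m : ℕ} (i : Fin m) (j : Fin n) → i ↑ˡ n ≢ m ↑ʳ j
↑ˡ≢↑ʳ {n} {m} i j eq with trans (sym (Fin.splitAt-↑ˡ m i n)) (trans (cong (Fin.splitAt m) eq) (Fin.splitAt-↑ʳ m n j))
... | ()

-- The points of the first design are kept; φ maps G' onto G and the rest of Fin v' onto the new
-- points v, …, v + (v' ∸ m) - 1.

module PointMap (v v' m : ℕ) (G : Subset v) (G' : Subset v') (∣G∣≡m : ∣ G ∣ ≡ m) (∣G'∣≡m : ∣ G' ∣ ≡ m) where
  N : ℕ
  N = v + (v' ∸ m)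

  ι : Fin v → Fin N
  ι x = x ↑ˡ (v' ∸ m)

  ι-injective : Injective _≡_ _≡_ ι
  ι-injective = Fin.↑ˡ-injective (v' ∸ m) _ _

  private
    module Matched = Correspondence
      (trans (length-elements G') (trans ∣G'∣≡m (trans (sym ∣G∣≡m) (sym (length-elements G)))))
      (elements-unique G') (elements-unique G)
    module Fresh = Correspondence
      (trans (length-elements (∁ G')) (trans (∣∁p∣≡n∸∣p∣ G') (trans (cong (v' ∸_) ∣G'∣≡m)
             (sym (List.length-tabulate {A = Fin (v' ∸ m)} (λ i → i))))))
      (elements-unique (∁ G')) (Unique.allFin⁺ (v' ∸ m))

    φ-cases : (y : Fin v') → Dec (y ∈ G') → Fin N
    φ-cases y (yes y∈G') = ι (Matched.partner (∈-elements⁺ G' y∈G'))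
    φ-cases y (no y∉G')  = v ↑ʳ Fresh.partner (∈-elements⁺ (∁ G') (x∉p⇒x∈∁p y∉G'))

    φ-cases-injective : ∀ {y₁ y₂} (d₁ : Dec (y₁ ∈ G')) (d₂ : Dec (y₂ ∈ G')) →
                        φ-cases y₁ d₁ ≡ φ-cases y₂ d₂ → y₁ ≡ y₂
    φ-cases-injective (yes _) (yes _) eq = Matched.partner-injective _ _ (ι-injective eq)
    φ-cases-injective (yes _) (no _)  eq = ⊥-elim (↑ˡ≢↑ʳ _ _ eq)
    φ-cases-injective (no _)  (yes _) eq = ⊥-elim (↑ˡ≢↑ʳ _ _ (sym eq))
    φ-cases-injective (no _)  (no _)  eq = Fresh.partner-injective _ _ (Fin.↑ʳ-injective v _ _ eq)

  φ : Fin v' → Fin N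
  φ y = φ-cases y (y ∈? G')

  φ-injective : Injective _≡_ _≡_ φ
  φ-injective {y₁} {y₂} = φ-cases-injective (y₁ ∈? G') (y₂ ∈? G')

  φ[G']⊆ι[G] : ∀ {y} → y ∈ G' → ∃[ x ] x ∈ G × φ y ≡ ι x
  φ[G']⊆ι[G] {y} y∈G' = go (y ∈? G')
    where
    go : (d : Dec (y ∈ G')) → ∃[ x ] x ∈ G × φ-cases y d ≡ ι x
    go (yes _)     = _ , ∈-elements⁻ G (Matched.partner-∈ _) , refl
    go (no y∉G')   = ⊥-elim (y∉G' y∈G')

  ι[G]⊆φ[G'] : ∀ {x} → x ∈ G → ∃[ y ] y ∈ G' × φ y ≡ ι x
  ι[G]⊆φ[G'] {x} x∈G with Matched.partner-surjective (∈-elements⁺ G x∈G)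
  ... | y , y∈ , partner≡x = y , ∈-elements⁻ G' y∈ , go (y ∈? G')
    where
    go : (d : Dec (y ∈ G')) → φ-cases y d ≡ ι x
    go (yes _)     = cong ι (trans (Matched.partner-irrelevant _ y∈) partner≡x)
    go (no y∉G')   = ⊥-elim (y∉G' (∈-elements⁻ G' y∈))

  φ≡ι⇒∈G' : ∀ {y x} → φ y ≡ ι x → y ∈ G'
  φ≡ι⇒∈G' {y} = go (y ∈? G')
    where
    go : ∀ {x} (d : Dec (y ∈ G')) → φ-cases y d ≡ ι x → y ∈ G'
    go (yes y∈G') _ = y∈G'
    go (no _) eq    = ⊥-elim (↑ˡ≢↑ʳ _ _ (sym eq))

  ι-or-φ : ∀ z → (∃[ x ] ι x ≡ z) ⊎ (∃[ y ] y ∉ G' × φ y ≡ z)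
  ι-or-φ z with Fin.splitAt v z in split≡
  ... | inj₁ x = inj₁ (x , Fin.splitAt⁻¹-↑ˡ split≡)
  ... | inj₂ w with Fresh.partner-surjective (∈-allFin w)
  ...   | y , y∈ , partner≡w = inj₂ (y , y∉G' , trans (go (y ∈? G')) (Fin.splitAt⁻¹-↑ʳ split≡))
    where
    y∉G' : y ∉ G'
    y∉G' = x∈∁p⇒x∉p (∈-elements⁻ (∁ G') y∈)
    go : (d : Dec (y ∈ G')) → φ-cases y d ≡ v ↑ʳ w
    go (yes y∈G') = ⊥-elim (y∉G' y∈G')
    go (no _)     = cong (v ↑ʳ_) (trans (Fresh.partner-irrelevant _ y∈) partner≡w)

-- Lists of blocks and lists of labelled subsets

at : List (Subset n) → ℕ → Subset n
at []       i       = ⊥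
at (B ∷ Bs) zero    = B
at (B ∷ Bs) (suc i) = at Bs i

module _ {n : ℕ} where
  at-++ˡ : (Bs Cs : List (Subset n)) {i : ℕ} → i < length Bs → at (Bs ++ Cs) i ≡ at Bs i
  at-++ˡ (B ∷ Bs) Cs {zero}  _         = refl
  at-++ˡ (B ∷ Bs) Cs {suc i} (s≤s i<) = at-++ˡ Bs Cs i<

  at-++ʳ : (Bs Cs : List (Subset n)) (i : ℕ) → at (Bs ++ Cs) (length Bs + i) ≡ at Cs i
  at-++ʳ []       Cs i = refl
  at-++ʳ (B ∷ Bs) Cs i = at-++ʳ Bs Cs i

  at-∈ : (Bs : List (Subset n)) {i : ℕ} → i < length Bs → at Bs i ∈ˡ Bs
  at-∈ (B ∷ Bs) {zero}  _         = here refl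
  at-∈ (B ∷ Bs) {suc i} (s≤s i<) = there (at-∈ Bs i<)

  ∈⇒at : {Bs : List (Subset n)} {B : Subset n} → B ∈ˡ Bs → ∃[ i ] i < length Bs × at Bs i ≡ B
  ∈⇒at (here refl) = zero , s≤s z≤n , refl
  ∈⇒at (there B∈) with ∈⇒at B∈
  ... | i , i< , eq = suc i , s≤s i< , eq

  module _ {R : Subset n → Subset n → Set} where
    Linked⇒at : {Bs : List (Subset n)} → Linked R Bs → ∀ {i} → suc i < length Bs → R (at Bs i) (at Bs (suc i))
    Linked⇒at [-]      {zero}  (s≤s ())
    Linked⇒at (r ∷ _)  {zero}  _         = r
    Linked⇒at [-]      {suc i} (s≤s ())
    Linked⇒at (_ ∷ rs) {suc i} (s≤s i<) = Linked⇒at rs i<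

    at⇒Linked : (Bs : List (Subset n)) → (∀ i → suc i < length Bs → R (at Bs i) (at Bs (suc i))) → Linked R Bs
    at⇒Linked []           _ = []
    at⇒Linked (B ∷ [])     _ = [-]
    at⇒Linked (B ∷ C ∷ Bs) r = r 0 (s≤s (s≤s z≤n)) ∷ at⇒Linked (C ∷ Bs) (λ i i< → r (suc i) (s≤s i<))

at-map : {m : ℕ} (f : Subset n → Subset m) (Bs : List (Subset n)) {i : ℕ} → i < length Bs →
         at (map f Bs) i ≡ f (at Bs i)
at-map f (B ∷ Bs) {zero}  _         = refl
at-map f (B ∷ Bs) {suc i} (s≤s i<) = at-map f Bs i<

at-tabulate : {b : ℕ} (f : Fin b → Subset n) (j : Fin b) → at (List.tabulate f) (toℕ j) ≡ f j
at-tabulate f zero    = refl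
at-tabulate f (suc j) = at-tabulate (f ∘ suc) j

Meet : ℕ → Subset n → Subset n → Set
Meet m A B = ∣ A ∩ B ∣ ≡ m

sccdFromList : ∀ {k b} (Bs : List (Subset n)) → length Bs ≡ b →
  All (λ B → ∣ B ∣ ≡ k) Bs → Linked (Meet (k ∸ 1)) Bs →
  (∀ x y → x ≢ y → ∃[ B ] B ∈ˡ Bs × x ∈ B × y ∈ B) → SCCD n k b
sccdFromList {n} {k} {b} Bs |Bs|≡b sizes linked covered = record
  { block        = λ j → at Bs (toℕ j)
  ; blockSize    = λ j → All.lookup sizes (at-∈ Bs (toℕ<|Bs| j))
  ; singleChange = λ i j j≡1+i → subst (λ t → Meet (k ∸ 1) (at Bs (toℕ i)) (at Bs t)) (sym j≡1+i)
                                   (Linked⇒at linked (subst (_< length Bs) j≡1+i (toℕ<|Bs| j)))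
  ; covers       = covers′
  }
  where
  toℕ<|Bs| : (j : Fin b) → toℕ j < length Bs
  toℕ<|Bs| j = subst (toℕ j <_) (sym |Bs|≡b) (Fin.toℕ<n j)
  covers′ : ∀ x y → x ≢ y → ∃[ j ] (x ∈ at Bs (toℕ j) × y ∈ at Bs (toℕ j))
  covers′ x y x≢y with covered x y x≢y
  ... | B , B∈ , x∈B , y∈B with ∈⇒at B∈
  ...   | i , i< , refl = fromℕ< i<b , subst (λ t → x ∈ at Bs t × y ∈ at Bs t) (sym (Fin.toℕ-fromℕ< i<b)) (x∈B , y∈B)
    where i<b = subst (i <_) |Bs|≡b i<

module _ {A : Set} where
  Keys-unique⇒≡ : {L : List (ℕ × A)} → Unique (map proj₁ L) →
                  ∀ {i S₁ S₂} → (i , S₁) ∈ˡ L → (i , S₂) ∈ˡ L → S₁ ≡ S₂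
  Keys-unique⇒≡ (_ ∷ _)  (here refl) (here refl) = refl
  Keys-unique⇒≡ (i∉ ∷ _) (here refl) (there ∈L)  = ⊥-elim (All.lookup i∉ (∈-map⁺ proj₁ ∈L) refl)
  Keys-unique⇒≡ (i∉ ∷ _) (there ∈L)  (here refl) = ⊥-elim (All.lookup i∉ (∈-map⁺ proj₁ ∈L) refl)
  Keys-unique⇒≡ (_ ∷ u)  (there ∈L)  (there ∈L′) = Keys-unique⇒≡ u ∈L ∈L′

  lookupKey : ℕ → List (ℕ × A) → Maybe A
  lookupKey t []            = nothing
  lookupKey t ((i , S) ∷ L) with i ≟ t
  ... | yes _ = just S
  ... | no _  = lookupKey t L

  lookupKey-∈ : ∀ t (L : List (ℕ × A)) {S} → lookupKey t L ≡ just S → (t , S) ∈ˡ L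
  lookupKey-∈ t ((i , S) ∷ L) eq with i ≟ t
  lookupKey-∈ t ((i , S) ∷ L) refl | yes refl = here refl
  ... | no _ = there (lookupKey-∈ t L eq)

  ∈⇒lookupKey : {L : List (ℕ × A)} → Unique (map proj₁ L) → ∀ {t S} → (t , S) ∈ˡ L → lookupKey t L ≡ just S
  ∈⇒lookupKey {(i , S′) ∷ L} u {t} ∈L with i ≟ t
  ∈⇒lookupKey {(i , S′) ∷ L} u        (here refl) | yes _    = refl
  ∈⇒lookupKey {(i , S′) ∷ L} u        (there ∈L)  | yes refl = cong just (Keys-unique⇒≡ u (here refl) (there ∈L))
  ∈⇒lookupKey {(i , S′) ∷ L} u        (here refl) | no i≢i   = ⊥-elim (i≢i refl)
  ∈⇒lookupKey {(i , S′) ∷ L} (_ ∷ u)  (there ∈L)  | no _     = ∈⇒lookupKey u ∈L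

  ∉⇒lookupKey : {L : List (ℕ × A)} (t : ℕ) → All (t ≢_) (map proj₁ L) → lookupKey t L ≡ nothing
  ∉⇒lookupKey {[]} t _ = refl
  ∉⇒lookupKey {(i , S) ∷ L} t (t≢i ∷ t∉) with i ≟ t
  ... | yes i≡t = ⊥-elim (t≢i (sym i≡t))
  ... | no _    = ∉⇒lookupKey t t∉

  withoutKey0 : List (ℕ × A) → List (ℕ × A)
  withoutKey0 []                  = []
  withoutKey0 ((zero , S) ∷ L)    = withoutKey0 L
  withoutKey0 ((suc t , S) ∷ L)   = (suc t , S) ∷ withoutKey0 L

  ∈-withoutKey0⁻ : {L : List (ℕ × A)} {p : ℕ × A} → p ∈ˡ withoutKey0 L → p ∈ˡ L × ∃[ t ] proj₁ p ≡ suc t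
  ∈-withoutKey0⁻ {(zero , S) ∷ L} ∈L with ∈-withoutKey0⁻ {L} ∈L
  ... | p∈ , key = there p∈ , key
  ∈-withoutKey0⁻ {(suc t , S) ∷ L} (here refl) = here refl , t , refl
  ∈-withoutKey0⁻ {(suc t , S) ∷ L} (there ∈L) with ∈-withoutKey0⁻ {L} ∈L
  ... | p∈ , key = there p∈ , key

  ∈-withoutKey0⁺ : {L : List (ℕ × A)} {t : ℕ} {S : A} → (suc t , S) ∈ˡ L → (suc t , S) ∈ˡ withoutKey0 L
  ∈-withoutKey0⁺ {(zero , S) ∷ L}  (there ∈L)  = ∈-withoutKey0⁺ ∈L
  ∈-withoutKey0⁺ {(suc t , S) ∷ L} (here refl) = here refl
  ∈-withoutKey0⁺ {(suc t , S) ∷ L} (there ∈L)  = there (∈-withoutKey0⁺ ∈L)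

  All-withoutKey0 : {P : ℕ × A → Set} {L : List (ℕ × A)} → All P L → All P (withoutKey0 L)
  All-withoutKey0 {L = []} [] = []
  All-withoutKey0 {L = (zero , S) ∷ L} (_ ∷ ps) = All-withoutKey0 ps
  All-withoutKey0 {L = (suc t , S) ∷ L} (p ∷ ps) = p ∷ All-withoutKey0 ps

  AllPairs-withoutKey0 : {R : ℕ × A → ℕ × A → Set} {L : List (ℕ × A)} → AllPairs R L → AllPairs R (withoutKey0 L)
  AllPairs-withoutKey0 {L = []} [] = []
  AllPairs-withoutKey0 {L = (zero , S) ∷ L} (_ ∷ rs) = AllPairs-withoutKey0 rs
  AllPairs-withoutKey0 {L = (suc t , S) ∷ L} (r ∷ rs) = All-withoutKey0 r ∷ AllPairs-withoutKey0 rs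

  Keys-unique-withoutKey0 : {L : List (ℕ × A)} → Unique (map proj₁ L) → Unique (map proj₁ (withoutKey0 L))
  Keys-unique-withoutKey0 {[]} [] = []
  Keys-unique-withoutKey0 {(zero , S) ∷ L} (_ ∷ u) = Keys-unique-withoutKey0 u
  Keys-unique-withoutKey0 {(suc t , S) ∷ L} (t∉ ∷ u) = keys t∉ ∷ Keys-unique-withoutKey0 u
    where
    keys : ∀ {L′ : List (ℕ × A)} → All (suc t ≢_) (map proj₁ L′) → All (suc t ≢_) (map proj₁ (withoutKey0 L′))
    keys {[]} [] = []
    keys {(zero , _) ∷ L′} (_ ∷ ns) = keys ns
    keys {(suc _ , _) ∷ L′} (n ∷ ns) = n ∷ keys ns

  length-withoutKey0 : {L : List (ℕ × A)} {S : A} → Unique (map proj₁ L) → (0 , S) ∈ˡ L →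
                       suc (length (withoutKey0 L)) ≡ length L
  length-withoutKey0 {(zero , S) ∷ L} (0∉ ∷ _) _ = cong suc (no-key0 0∉)
    where
    no-key0 : ∀ {L′ : List (ℕ × A)} → All (0 ≢_) (map proj₁ L′) → length (withoutKey0 L′) ≡ length L′
    no-key0 {[]} [] = refl
    no-key0 {(zero , _) ∷ L′} (0≢0 ∷ _) = ⊥-elim (0≢0 refl)
    no-key0 {(suc _ , _) ∷ L′} (_ ∷ ns) = cong suc (no-key0 ns)
  length-withoutKey0 {(suc t , S) ∷ L} (_ ∷ u) (there ∈L) = cong suc (length-withoutKey0 u ∈L)

sumFrom : (ℕ → ℕ) → ℕ → ℕ → ℕ
sumFrom f t zero    = 0
sumFrom f t (suc r) = f t + sumFrom f (suc t) r

sumFrom-cong : ∀ {f g : ℕ → ℕ} t r → (∀ i → f i ≡ g i) → sumFrom f t r ≡ sumFrom g t r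
sumFrom-cong t zero    f≗g = refl
sumFrom-cong t (suc r) f≗g = cong₂ _+_ (f≗g t) (sumFrom-cong (suc t) r f≗g)

sumFrom-+ : ∀ f g t r → sumFrom (λ i → f i + g i) t r ≡ sumFrom f t r + sumFrom g t r
sumFrom-+ f g t zero    = refl
sumFrom-+ f g t (suc r) = trans (cong (f t + g t +_) (sumFrom-+ f g (suc t) r))
                                (+-interchange (f t) (g t) (sumFrom f (suc t) r) (sumFrom g (suc t) r))
  where
  +-interchange : ∀ a b c d → a + b + (c + d) ≡ a + c + (b + d)
  +-interchange = solve-∀

sumFrom-suc : ∀ f t r → sumFrom f (suc t) r ≡ sumFrom (f ∘ suc) t r
sumFrom-suc f t zero    = refl
sumFrom-suc f t (suc r) = cong (f (suc t) +_) (sumFrom-suc f (suc t) r)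

indicator : ℕ → ℕ → ℕ
indicator x j with x ≟ j
... | yes _ = 1
... | no _  = 0

sumFrom-indicator : ∀ x t r → t ≤ x → x < t + r → sumFrom (indicator x) t r ≡ 1
sumFrom-indicator x t zero    t≤x x< = ⊥-elim (<-irrefl refl (≤-trans (s≤s t≤x) (≤-trans x< (≤-reflexive (+-identityʳ t)))))
sumFrom-indicator x t (suc r) t≤x x< with x ≟ t
... | yes refl = cong suc (sumFrom-beyond (suc x) r (n<1+n x))
  where
  sumFrom-beyond : ∀ t r → x < t → sumFrom (indicator x) t r ≡ 0
  sumFrom-beyond t zero    _   = refl
  sumFrom-beyond t (suc r) x<t with x ≟ t
  ... | yes refl = ⊥-elim (<-irrefl refl x<t)
  ... | no _     = sumFrom-beyond (suc t) r (≤-trans x<t (n≤1+n t))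
... | no x≢t = sumFrom-indicator x (suc t) r (≤∧≢⇒< t≤x (x≢t ∘ sym)) (subst (x <_) (+-suc t r) x<)

isJust : {A : Set} → Maybe A → ℕ
isJust nothing  = 0
isJust (just _) = 1

sumFrom-isJust-lookupKey : {A : Set} (L : List (ℕ × A)) (n : ℕ) → Unique (map proj₁ L) → All (λ p → proj₁ p < n) L →
                           sumFrom (λ j → isJust (lookupKey j L)) 0 n ≡ length L
sumFrom-isJust-lookupKey [] n _ _ = empty n 0
  where
  empty : ∀ n t → sumFrom (λ _ → 0) t n ≡ 0
  empty zero    t = refl
  empty (suc n) t = empty n (suc t)
sumFrom-isJust-lookupKey ((x , S) ∷ L) n (x∉ ∷ u) (x<n ∷ keys<n) = begin
  sumFrom (λ j → isJust (lookupKey j ((x , S) ∷ L))) 0 n                    ≡⟨ sumFrom-cong 0 n split ⟩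
  sumFrom (λ j → indicator x j + isJust (lookupKey j L)) 0 n                ≡⟨ sumFrom-+ (indicator x) _ 0 n ⟩
  sumFrom (indicator x) 0 n + sumFrom (λ j → isJust (lookupKey j L)) 0 n    ≡⟨ cong₂ _+_ (sumFrom-indicator x 0 n z≤n x<n)
                                                                                        (sumFrom-isJust-lookupKey L n u keys<n) ⟩
  suc (length L)                                                           ∎
  where
  open ≡-Reasoning
  split : ∀ j → isJust (lookupKey j ((x , S) ∷ L)) ≡ indicator x j + isJust (lookupKey j L)
  split j with x ≟ j
  ... | yes refl = cong suc (sym (cong isJust (∉⇒lookupKey x x∉)))
  ... | no _     = refl

Unique-map-on : {A B : Set} {P : A → Set} (f : A → B) {xs : List A} → All P xs →
                (∀ {x y} → P x → P y → f x ≡ f y → x ≡ y) → Unique xs → Unique (map f xs)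
Unique-map-on f [] f-inj [] = []
Unique-map-on f (px ∷ ps) f-inj (x∉ ∷ u) = images ps x∉ ∷ Unique-map-on f ps f-inj u
  where
  images : ∀ {ys} → All _ ys → All (_ ≢_) ys → All (f _ ≢_) (map f ys)
  images [] [] = []
  images (py ∷ pys) (x≢y ∷ x∉) = (x≢y ∘ f-inj px py) ∷ images pys x∉

-- Reversing the order of the blocks of a design

Unchanged⇒≤ : ∀ {v k b} {D : SCCD v k b} {i U} → Unchanged D i U → i ≤ b
Unchanged⇒≤ (inj₁ (refl , _))                    = z≤n
Unchanged⇒≤ (inj₂ (inj₁ (refl , _)))             = ≤-refl
Unchanged⇒≤ (inj₂ (inj₂ (_ , j′ , _ , refl , _))) = <⇒≤ (Fin.toℕ<n j′)

m∸n≡1+m∸[1+n] : ∀ m n → n < m → m ∸ n ≡ suc (m ∸ suc n)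
m∸n≡1+m∸[1+n] (suc m) zero    _         = refl
m∸n≡1+m∸[1+n] (suc m) (suc n) (s≤s n<m) = m∸n≡1+m∸[1+n] m n n<m

opposite-adjacent : {b : ℕ} (i j : Fin b) → toℕ j ≡ suc (toℕ i) →
                    toℕ (Fin.opposite i) ≡ suc (toℕ (Fin.opposite j))
opposite-adjacent {b} i j j≡1+i = begin
  toℕ (Fin.opposite i)        ≡⟨ Fin.opposite-prop i ⟩
  b ∸ suc (toℕ i)             ≡⟨ m∸n≡1+m∸[1+n] b (suc (toℕ i)) (subst (_< b) j≡1+i (Fin.toℕ<n j)) ⟩
  suc (b ∸ suc (suc (toℕ i))) ≡⟨ cong (λ t → suc (b ∸ suc t)) j≡1+i ⟨
  suc (b ∸ suc (toℕ j))       ≡⟨ cong suc (Fin.opposite-prop j) ⟨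
  suc (toℕ (Fin.opposite j))  ∎
  where open ≡-Reasoning

module Reverse {v k b : ℕ} (D : SCCD v k b) where
  reverse : SCCD v k b
  reverse = record
    { block        = block D ∘ Fin.opposite
    ; blockSize    = blockSize D ∘ Fin.opposite
    ; singleChange = λ i j j≡1+i →
        trans (cong ∣_∣ (∩-comm (block D (Fin.opposite i)) (block D (Fin.opposite j))))
              (singleChange D (Fin.opposite j) (Fin.opposite i) (opposite-adjacent i j j≡1+i))
    ; covers       = λ x y x≢y → let j , x∈ , y∈ = covers D x y x≢y in
        Fin.opposite j , subst (λ c → x ∈ block D c × y ∈ block D c) (sym (Fin.opposite-involutive j)) (x∈ , y∈)
    }

  reverseIndex : {A : Set} → ℕ × A → ℕ × A
  reverseIndex p = b ∸ proj₁ p , proj₂ p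

  Unchanged-reverse : ∀ {i U} → Unchanged D i U → Unchanged reverse (b ∸ i) U
  Unchanged-reverse {U = U} (inj₁ (refl , j , j≡0 , U⊆ , ∣U∣)) =
    inj₂ (inj₁ (refl , Fin.opposite j , last , subst (λ c → U ⊆ block D c) (sym (Fin.opposite-involutive j)) U⊆ , ∣U∣))
    where
    last : suc (toℕ (Fin.opposite j)) ≡ b
    last = begin
      suc (toℕ (Fin.opposite j))  ≡⟨ cong suc (Fin.opposite-prop j) ⟩
      suc (b ∸ suc (toℕ j))       ≡⟨ cong (λ t → suc (b ∸ suc t)) j≡0 ⟩
      suc (b ∸ 1)                 ≡⟨ m∸n≡1+m∸[1+n] b 0 (subst (_< b) j≡0 (Fin.toℕ<n j)) ⟨
      b                           ∎
      where open ≡-Reasoning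
  Unchanged-reverse {U = U} (inj₂ (inj₁ (refl , j , 1+j≡b , U⊆ , ∣U∣))) =
    inj₁ (n∸n≡0 b , Fin.opposite j ,
          trans (Fin.opposite-prop j) (trans (cong (b ∸_) 1+j≡b) (n∸n≡0 b)) ,
          subst (λ c → U ⊆ block D c) (sym (Fin.opposite-involutive j)) U⊆ , ∣U∣)
  Unchanged-reverse (inj₂ (inj₂ (j , j′ , j′≡1+j , refl , refl))) =
    inj₂ (inj₂ (Fin.opposite j′ , Fin.opposite j , opposite-adjacent j j′ j′≡1+j ,
                trans (cong (b ∸_) j′≡1+j) (sym (Fin.opposite-prop j)) ,
                trans (∩-comm (block D j) (block D j′))
                      (sym (cong₂ _∩_ (cong (block D) (Fin.opposite-involutive j′))
                                      (cong (block D) (Fin.opposite-involutive j))))))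

  IsExpansionSet-reverse : ∀ {L} → IsExpansionSet D L → IsExpansionSet reverse (map reverseIndex L)
  IsExpansionSet-reverse {L} E = record
    { unchanged = All.map⁺ (All.map Unchanged-reverse E.unchanged)
    ; distinct  = subst Unique (trans (sym (List.map-∘ {g = b ∸_} {f = proj₁} L)) (List.map-∘ L))
        (Unique-map-on (b ∸_) (All.tabulate index≤b)
          (λ i≤b j≤b eq → trans (sym (m∸[m∸n]≡n i≤b)) (trans (cong (b ∸_) eq) (m∸[m∸n]≡n j≤b)))
          E.distinct)
    ; count     = trans (cong (_* (k ∸ 1)) (List.length-map reverseIndex L)) E.count
    ; disjoint  = AllPairs.map⁺ E.disjoint
    ; cover     = λ x → Any.map⁺ (E.cover x)
    }
    where
    module E = IsExpansionSet E
    index≤b : ∀ {i} → i ∈ˡ map proj₁ L → i ≤ b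
    index≤b i∈ with ∈-map⁻ proj₁ i∈
    ... | _ , p∈ , refl = Unchanged⇒≤ {D = D} (All.lookup E.unchanged p∈)

-- Deciding whether a design has an expansion set containing U_b

allSubsets : ∀ n → List (Subset n)
allSubsets zero    = [] ∷ []
allSubsets (suc n) = map (outside ∷_) (allSubsets n) ++ map (inside ∷_) (allSubsets n)

∈-allSubsets : (p : Subset n) → p ∈ˡ allSubsets n
∈-allSubsets [] = here refl
∈-allSubsets (outside ∷ p) = ∈-++⁺ˡ (∈-map⁺ (outside ∷_) (∈-allSubsets p))
∈-allSubsets (inside ∷ p)  = ∈-++⁺ʳ (map (outside ∷_) (allSubsets _)) (∈-map⁺ (inside ∷_) (∈-allSubsets p))

module _ {A : Set} (candidates : List A) where
  BoundedWitness : (List A → Set) → ℕ → Set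
  BoundedWitness P n = ∃[ xs ] length xs ≤ n × All (_∈ˡ candidates) xs × P xs

  boundedWitness? : (P : List A → Set) → (∀ xs → Dec (P xs)) → ∀ n → Dec (BoundedWitness P n)
  boundedWitness? P P? zero with P? []
  ... | yes p[] = yes ([] , z≤n , [] , p[])
  ... | no ¬p[] = no λ { ([] , _ , _ , p[]) → ¬p[] p[] ; (_ ∷ _ , () , _) }
  boundedWitness? P P? (suc n)
    with P? [] | Any.any? (λ c → boundedWitness? (P ∘ (c ∷_)) (P? ∘ (c ∷_)) n) candidates
  ... | yes p[] | _ = yes ([] , z≤n , [] , p[])
  ... | no _ | yes extends with find extends
  ...   | c , c∈ , xs , |xs|≤n , xs⊆ , p = yes (c ∷ xs , s≤s |xs|≤n , c∈ ∷ xs⊆ , p)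
  boundedWitness? P P? (suc n) | no ¬p[] | no ¬extends = no λ
    { ([] , _ , _ , p[]) → ¬p[] p[]
    ; (c ∷ xs , s≤s |xs|≤n , c∈ ∷ xs⊆ , p) → ¬extends (lose c∈ (xs , |xs|≤n , xs⊆ , p)) }

module _ {v k b : ℕ} (D : SCCD v k b) where
  unchanged? : ∀ i U → Dec (Unchanged D i U)
  unchanged? i U =
    (i ≟ 0 ×-dec Fin.any? (λ j → toℕ j ≟ 0 ×-dec (U ⊆? block D j ×-dec ∣ U ∣ ≟ k ∸ 1)))
    ⊎-dec ((i ≟ b ×-dec Fin.any? (λ j → suc (toℕ j) ≟ b ×-dec (U ⊆? block D j ×-dec ∣ U ∣ ≟ k ∸ 1)))
    ⊎-dec Fin.any? (λ j → Fin.any? (λ j′ → toℕ j′ ≟ suc (toℕ j)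
                     ×-dec (i ≟ toℕ j′ ×-dec Vec.≡-dec Bool._≟_ U (block D j ∩ block D j′)))))

  isExpansionSet? : ∀ L → Dec (IsExpansionSet D L)
  isExpansionSet? L = map′
    (λ (u , d , c , e , cov) → record { unchanged = u ; distinct = d ; count = c ; disjoint = e ; cover = cov })
    (λ E → let open IsExpansionSet E in unchanged , distinct , count , disjoint , cover)
    (All.all? (λ p → unchanged? (proj₁ p) (proj₂ p)) L
      ×-dec (AllPairs.allPairs? (λ i j → ¬? (i ≟ j)) (map proj₁ L)
      ×-dec (length L * (k ∸ 1) ≟ v
      ×-dec (AllPairs.allPairs? (λ p q → ¬? (nonempty? (proj₂ p ∩ proj₂ q))) L
      ×-dec Fin.all? (λ x → Any.any? (λ p → x ∈? proj₂ p) L)))))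

  ExpansionSetWithLast : Set
  ExpansionSetWithLast = ∃[ L ] IsExpansionSet D L × Any (λ p → proj₁ p ≡ b) L

  private
    candidates : List (ℕ × Subset v)
    candidates = List.cartesianProduct (List.upTo (suc b)) (allSubsets v)

    candidate : ∀ {i U} → Unchanged D i U → (i , U) ∈ˡ candidates
    candidate {U = U} u = ∈-cartesianProduct⁺ (∈-upTo⁺ (s≤s (Unchanged⇒≤ {D = D} u))) (∈-allSubsets U)

    length≤v : 2 ≤ k → ∀ {L} → IsExpansionSet D L → length L ≤ v
    length≤v 2≤k {L} E = begin
      length L             ≡⟨ *-identityʳ (length L) ⟨
      length L * 1         ≤⟨ *-monoʳ-≤ (length L) (∸-monoˡ-≤ 1 2≤k) ⟩
      length L * (k ∸ 1)   ≡⟨ IsExpansionSet.count E ⟩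
      v                    ∎
      where open ≤-Reasoning

  expansionSetWithLast? : 2 ≤ k → Dec ExpansionSetWithLast
  expansionSetWithLast? 2≤k
    with boundedWitness? candidates (λ L → IsExpansionSet D L × Any (λ p → proj₁ p ≡ b) L)
                         (λ L → isExpansionSet? L ×-dec Any.any? (λ p → proj₁ p ≟ b) L) v
  ... | yes (L , _ , _ , E) = yes (L , E)
  ... | no ¬bounded = no λ (L , E , last∈) →
          ¬bounded (L , length≤v 2≤k E , All.map candidate (IsExpansionSet.unchanged E) , E , last∈)

-- The glued design

Unchanged-0 : ∀ {v k b} {D : SCCD v k b} {U} → Unchanged D 0 U →
              Σ (Fin b) λ j → toℕ j ≡ 0 × U ⊆ block D j × ∣ U ∣ ≡ k ∸ 1
Unchanged-0 (inj₁ (_ , first)) = first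
Unchanged-0 (inj₂ (inj₁ (refl , _ , () , _)))
Unchanged-0 (inj₂ (inj₂ (_ , _ , j′≡1+j , 0≡j′ , _))) = ⊥-elim (0≢1+n (trans 0≡j′ j′≡1+j))

module Glue (v v' m b b' : ℕ) (D : SCCD v (suc m) b) (D' : SCCD v' (suc m) b')
  (G : Subset v) (last : Fin b) (1+last≡b : suc (toℕ last) ≡ b) (G⊆last : G ⊆ block D last) (∣G∣≡m : ∣ G ∣ ≡ m)
  (L' : List (ℕ × Subset v')) (E' : IsExpansionSet D' L') (G' : Subset v') (0,G'∈L' : (0 , G') ∈ˡ L')
  where
  module E' = IsExpansionSet E'

  private
    firstEntry : Σ (Fin b') λ j → toℕ j ≡ 0 × G' ⊆ block D' j × ∣ G' ∣ ≡ m
    firstEntry = Unchanged-0 {D = D'} (All.lookup E'.unchanged 0,G'∈L')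

  first : Fin b'
  first = proj₁ firstEntry

  first≡0 : toℕ first ≡ 0
  first≡0 = proj₁ (proj₂ firstEntry)

  G'⊆first : G' ⊆ block D' first
  G'⊆first = proj₁ (proj₂ (proj₂ firstEntry))

  ∣G'∣≡m : ∣ G' ∣ ≡ m
  ∣G'∣≡m = proj₂ (proj₂ (proj₂ firstEntry))

  open PointMap v v' m G G' ∣G∣≡m ∣G'∣≡m public

  ι̂ : Subset v → Subset N
  ι̂ = image ι

  φ̂ : Subset v' → Subset N
  φ̂ = image φ

  ι∉φ̂ : (A : Subset v') {x : Fin v} → x ∉ G → ι x ∉ φ̂ A
  ι∉φ̂ A x∉G ιx∈ with ∈-image⁻ φ A ιx∈
  ... | y , _ , φy≡ιx with φ[G']⊆ι[G] (φ≡ι⇒∈G' {y = y} φy≡ιx)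
  ...   | x′ , x′∈G , φy≡ιx′ = x∉G (subst (_∈ G) (ι-injective (trans (sym φy≡ιx′) φy≡ιx)) x′∈G)

  ∈ι̂∩φ̂⇒∈φ̂G' : {B : Subset v} {A : Subset v'} {z : Fin N} → z ∈ ι̂ B → z ∈ φ̂ A → ∃[ y ] y ∈ A × y ∈ G' × φ y ≡ z
  ∈ι̂∩φ̂⇒∈φ̂G' {B} {A} z∈ι̂ z∈φ̂ with ∈-image⁻ ι B z∈ι̂ | ∈-image⁻ φ A z∈φ̂
  ... | _ , _ , ιx≡z | y , y∈A , refl = y , y∈A , φ≡ι⇒∈G' {y = y} (sym ιx≡z) , refl

  blocks : List (Subset v)
  blocks = List.tabulate (block D)

  blocks' : List (Subset v')
  blocks' = List.tabulate (block D')

  at-blocks' : (j : Fin b') {t : ℕ} → toℕ j ≡ t → at blocks' t ≡ block D' j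
  at-blocks' j refl = at-tabulate (block D') j

  points∉G : List (Fin v)
  points∉G = elements (∁ G)

  spoke : Subset v' → Fin v → Subset N
  spoke S x = φ̂ S ∪ ⁅ ι x ⁆

  spokes : Maybe (Subset v') → List (Subset N)
  spokes nothing  = []
  spokes (just S) = map (spoke S) points∉G

  -- Block t of the second design (0-based) is followed by the spokes of U'_(t+1), if it is in the
  -- expansion set.
  glued : ℕ → ℕ → List (Subset N)
  glued zero    t = []
  glued (suc r) t = φ̂ (at blocks' t) ∷ (spokes (lookupKey (suc t) L') ++ glued r (suc t))

  blocks* : List (Subset N)
  blocks* = map ι̂ blocks ++ glued b' 0

  record InnerEntry (t : ℕ) (S : Subset v') : Set where
    field
      t<b'       : t < b'
      ∣S∣≡m      : ∣ S ∣ ≡ m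
      S⊆left     : S ⊆ at blocks' t
      S⊆right    : suc t < b' → S ⊆ at blocks' (suc t)
      S∩G'-empty : Empty (S ∩ G')

  inner∩G'-empty : ∀ {t S} → (suc t , S) ∈ˡ L' → Empty (S ∩ G')
  inner∩G'-empty ∈L' with ∈-AllPairs₂ E'.disjoint ∈L' 0,G'∈L'
  ... | inj₁ ()
  ... | inj₂ (inj₁ empty) = empty
  ... | inj₂ (inj₂ empty) = Empty-∩-comm empty

  innerEntry : ∀ {t S} → (suc t , S) ∈ˡ L' → InnerEntry t S
  innerEntry {t} {S} ∈L' with All.lookup E'.unchanged ∈L'
  ... | inj₁ (() , _)
  ... | inj₂ (inj₁ (1+t≡b' , j , 1+j≡b' , S⊆ , ∣S∣)) = record
    { t<b'       = subst (t <_) 1+t≡b' ≤-refl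
    ; ∣S∣≡m      = ∣S∣
    ; S⊆left     = subst (S ⊆_) (sym (at-blocks' j (suc-injective (trans 1+j≡b' (sym 1+t≡b'))))) S⊆
    ; S⊆right    = λ 1+t<b' → ⊥-elim (<-irrefl 1+t≡b' 1+t<b')
    ; S∩G'-empty = inner∩G'-empty ∈L'
    }
  ... | inj₂ (inj₂ (j , j′ , j′≡1+j , 1+t≡j′ , refl)) = record
    { t<b'       = <⇒≤ (subst (_< b') (sym 1+t≡j′) (Fin.toℕ<n j′))
    ; ∣S∣≡m      = singleChange D' j j′ j′≡1+j
    ; S⊆left     = subst (S ⊆_) (sym (at-blocks' j (sym (suc-injective (trans 1+t≡j′ j′≡1+j))))) (p∩q⊆p _ _)
    ; S⊆right    = λ _ → subst (S ⊆_) (sym (at-blocks' j′ (sym 1+t≡j′))) (p∩q⊆q _ _)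
    ; S∩G'-empty = inner∩G'-empty ∈L'
    }

  at-blocks'< : ∀ {t} (t< : t < b') → at blocks' t ≡ block D' (fromℕ< t<)
  at-blocks'< t< = at-blocks' (fromℕ< t<) (Fin.toℕ-fromℕ< t<)

  at-blocks< : ∀ {t} (t< : t < b) → at blocks t ≡ block D (fromℕ< t<)
  at-blocks< t< = trans (cong (at blocks) (sym (Fin.toℕ-fromℕ< t<))) (at-tabulate (block D) (fromℕ< t<))

  ∣at-blocks'∣ : ∀ {t} → t < b' → ∣ at blocks' t ∣ ≡ suc m
  ∣at-blocks'∣ t< = trans (cong ∣_∣ (at-blocks'< t<)) (blockSize D' _)

  Meet-at-blocks' : ∀ {t} → suc t < b' → Meet m (at blocks' t) (at blocks' (suc t))
  Meet-at-blocks' {t} 1+t< = trans (cong₂ (λ A B → ∣ A ∩ B ∣) (at-blocks'< (<⇒≤ 1+t<)) (at-blocks'< 1+t<))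
    (singleChange D' _ _ (trans (Fin.toℕ-fromℕ< 1+t<) (cong suc (sym (Fin.toℕ-fromℕ< (<⇒≤ 1+t<))))))

  Meet-at-blocks : ∀ {t} → suc t < b → Meet m (at blocks t) (at blocks (suc t))
  Meet-at-blocks {t} 1+t< = trans (cong₂ (λ A B → ∣ A ∩ B ∣) (at-blocks< (<⇒≤ 1+t<)) (at-blocks< 1+t<))
    (singleChange D _ _ (trans (Fin.toℕ-fromℕ< 1+t<) (cong suc (sym (Fin.toℕ-fromℕ< (<⇒≤ 1+t<))))))

  ∈points∉G⇒∉G : ∀ {x} → x ∈ˡ points∉G → x ∉ G
  ∈points∉G⇒∉G x∈ = x∈∁p⇒x∉p (∈-elements⁻ (∁ G) x∈)

  ∣spoke∣ : ∀ S x → ∣ S ∣ ≡ m → x ∉ G → ∣ spoke S x ∣ ≡ suc m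
  ∣spoke∣ S x ∣S∣≡m x∉G =
    trans (x∉p⇒∣p∪⁅x⁆∣≡1+∣p∣ (φ̂ S) (ι x) (ι∉φ̂ S x∉G)) (cong suc (trans (∣image∣ φ-injective S) ∣S∣≡m))

  Meet-spoke-spoke : ∀ S {x y} → ∣ S ∣ ≡ m → x ∉ G → y ∉ G → x ≢ y → Meet m (spoke S x) (spoke S y)
  Meet-spoke-spoke S {x} {y} ∣S∣≡m x∉G y∉G x≢y =
    trans (cong ∣_∣ (∪⁅x⁆∩-cancel (φ̂ S) (spoke S y) (ι x) (p⊆p∪q ⁅ ι y ⁆) ιx∉))
          (trans (∣image∣ φ-injective S) ∣S∣≡m)
    where
    ιx∉ : ι x ∉ spoke S y
    ιx∉ ιx∈ with x∈p∪q⁻ (φ̂ S) _ ιx∈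
    ... | inj₁ ιx∈φ̂S = ι∉φ̂ S x∉G ιx∈φ̂S
    ... | inj₂ ιx≡ιy = x≢y (ι-injective (x∈⁅y⁆⇒x≡y _ ιx≡ιy))

  Meet-spoke-block : ∀ S B {x} → ∣ S ∣ ≡ m → S ⊆ B → x ∉ G → Meet m (spoke S x) (φ̂ B)
  Meet-spoke-block S B ∣S∣≡m S⊆B x∉G =
    trans (cong ∣_∣ (∪⁅x⁆∩-cancel (φ̂ S) (φ̂ B) _ (image-mono φ S⊆B) (ι∉φ̂ B x∉G)))
          (trans (∣image∣ φ-injective S) ∣S∣≡m)

  Meet-block-spoke : ∀ S B {x} → ∣ S ∣ ≡ m → S ⊆ B → x ∉ G → Meet m (φ̂ B) (spoke S x)
  Meet-block-spoke S B {x} ∣S∣≡m S⊆B x∉G =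
    trans (cong ∣_∣ (∩-comm (φ̂ B) (spoke S x))) (Meet-spoke-block S B ∣S∣≡m S⊆B x∉G)

  spokes-Linked : ∀ S → ∣ S ∣ ≡ m → (xs : List (Fin v)) → Unique xs → All (_∉ G) xs →
    ∀ rest → Linked (Meet m) rest → (∀ x → x ∉ G → Connected (Meet m) (just (spoke S x)) (List.head rest)) →
    Linked (Meet m) (map (spoke S) xs ++ rest)
  spokes-Linked S ∣S∣≡m [] _ _ rest linked connected = linked
  spokes-Linked S ∣S∣≡m (x ∷ []) _ (x∉G ∷ _) rest linked connected = connected x x∉G ∷′ linked
  spokes-Linked S ∣S∣≡m (x ∷ y ∷ xs) (x∉ ∷ u) (x∉G ∷ y∉G ∷ ∉G) rest linked connected =
    Meet-spoke-spoke S ∣S∣≡m x∉G y∉G (All.lookup x∉ (here refl)) ∷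
    spokes-Linked S ∣S∣≡m (y ∷ xs) u (y∉G ∷ ∉G) rest linked connected

  block-spokes-Connected : ∀ B S → ∣ S ∣ ≡ m → S ⊆ B → (xs : List (Fin v)) → All (_∉ G) xs → ∀ rest →
    Connected (Meet m) (just (φ̂ B)) (List.head rest) →
    Connected (Meet m) (just (φ̂ B)) (List.head (map (spoke S) xs ++ rest))
  block-spokes-Connected B S ∣S∣≡m S⊆B [] _ rest connected = connected
  block-spokes-Connected B S ∣S∣≡m S⊆B (x ∷ xs) (x∉G ∷ _) rest _ = just (Meet-block-spoke S B ∣S∣≡m S⊆B x∉G)

  glued-head-Connected : ∀ r t → suc t + r ≤ b' → ∀ A → (suc t < b' → Meet m A (φ̂ (at blocks' (suc t)))) →
    Connected (Meet m) (just A) (List.head (glued r (suc t)))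
  glued-head-Connected zero    t _    A _    = just-nothing
  glued-head-Connected (suc r) t 1+t+r≤ A meet = just (meet (<-≤-trans (m<m+n (suc t) (s≤s z≤n)) 1+t+r≤))

  points∉G-∉G : All (_∉ G) points∉G
  points∉G-∉G = All.tabulate ∈points∉G⇒∉G

  glued-Linked : ∀ r t → t + r ≤ b' → Linked (Meet m) (glued r t)
  glued-Linked zero    t _     = []
  glued-Linked (suc r) t t+r≤ = step (lookupKey (suc t) L') refl
    where
    1+t+r≤ : suc t + r ≤ b'
    1+t+r≤ = subst (_≤ b') (+-suc t r) t+r≤
    blockToNext : Connected (Meet m) (just (φ̂ (at blocks' t))) (List.head (glued r (suc t)))
    blockToNext = glued-head-Connected r t 1+t+r≤ _
      (λ 1+t< → trans (∣image-∩∣ φ-injective (at blocks' t) (at blocks' (suc t))) (Meet-at-blocks' 1+t<))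
    step : ∀ s → lookupKey (suc t) L' ≡ s →
           Linked (Meet m) (φ̂ (at blocks' t) ∷ (spokes s ++ glued r (suc t)))
    step nothing _ = blockToNext ∷′ glued-Linked r (suc t) 1+t+r≤
    step (just S) lookup≡ =
      block-spokes-Connected (at blocks' t) S ∣S∣≡m S⊆left points∉G points∉G-∉G (glued r (suc t)) blockToNext
      ∷′ spokes-Linked S ∣S∣≡m points∉G (elements-unique (∁ G)) points∉G-∉G (glued r (suc t))
           (glued-Linked r (suc t) 1+t+r≤)
           (λ x x∉G → glued-head-Connected r t 1+t+r≤ (spoke S x)
              (λ 1+t< → Meet-spoke-block S _ ∣S∣≡m (S⊆right 1+t<) x∉G))
      where open InnerEntry (innerEntry (lookupKey-∈ (suc t) L' lookup≡))

  glued-sizes : ∀ r t → t + r ≤ b' → All (λ B → ∣ B ∣ ≡ suc m) (glued r t)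
  glued-sizes zero    t _    = []
  glued-sizes (suc r) t t+r≤ = trans (∣image∣ φ-injective (at blocks' t)) (∣at-blocks'∣ t<b')
                               ∷ All.++⁺ (spokes-sizes (lookupKey (suc t) L') refl) (glued-sizes r (suc t) 1+t+r≤)
    where
    1+t+r≤ : suc t + r ≤ b'
    1+t+r≤ = subst (_≤ b') (+-suc t r) t+r≤
    t<b' : t < b'
    t<b' = <-≤-trans (m<m+n t (s≤s z≤n)) t+r≤
    spokes-sizes : ∀ s → lookupKey (suc t) L' ≡ s → All (λ B → ∣ B ∣ ≡ suc m) (spokes s)
    spokes-sizes nothing _ = []
    spokes-sizes (just S) lookup≡ = All.map⁺ (All.tabulate λ {x} x∈ → ∣spoke∣ S x ∣S∣≡m (∈points∉G⇒∉G x∈))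
      where open InnerEntry (innerEntry (lookupKey-∈ (suc t) L' lookup≡))

  glued-+ : ∀ r₁ r₂ t → glued (r₁ + r₂) t ≡ glued r₁ t ++ glued r₂ (t + r₁)
  glued-+ zero     r₂ t = cong (glued r₂) (sym (+-identityʳ t))
  glued-+ (suc r₁) r₂ t = cong (φ̂ (at blocks' t) ∷_) (begin
    spokes s ++ glued (r₁ + r₂) (suc t)                    ≡⟨ cong (spokes s ++_) (glued-+ r₁ r₂ (suc t)) ⟩
    spokes s ++ (glued r₁ (suc t) ++ glued r₂ (suc t + r₁)) ≡⟨ cong (λ u → spokes s ++ (glued r₁ (suc t) ++ glued r₂ u)) (+-suc t r₁) ⟨
    spokes s ++ (glued r₁ (suc t) ++ glued r₂ (t + suc r₁)) ≡⟨ List.++-assoc (spokes s) (glued r₁ (suc t)) _ ⟨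
    (spokes s ++ glued r₁ (suc t)) ++ glued r₂ (t + suc r₁) ∎)
    where
    open ≡-Reasoning
    s = lookupKey (suc t) L'

  length-ι̂blocks : length (map ι̂ blocks) ≡ b
  length-ι̂blocks = trans (List.length-map ι̂ blocks) (List.length-tabulate (block D))

  length-blocks* : length blocks* ≡ b + length (glued b' 0)
  length-blocks* = trans (List.length-++ (map ι̂ blocks)) (cong (_+ length (glued b' 0)) length-ι̂blocks)

  at-blocks*-ι̂ : ∀ {i} → i < b → at blocks* i ≡ ι̂ (at blocks i)
  at-blocks*-ι̂ {i} i<b = trans (at-++ˡ (map ι̂ blocks) (glued b' 0) (subst (i <_) (sym length-ι̂blocks) i<b))
                              (at-map ι̂ blocks (subst (i <_) (sym (List.length-tabulate (block D))) i<b))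

  at-blocks*-glued : ∀ d → at blocks* (b + d) ≡ at (glued b' 0) d
  at-blocks*-glued d = subst (λ c → at blocks* (c + d) ≡ at (glued b' 0) d) length-ι̂blocks
                             (at-++ʳ (map ι̂ blocks) (glued b' 0) d)

  0<b' : 0 < b'
  0<b' = subst (_< b') first≡0 (Fin.toℕ<n first)

  junction : ι̂ (block D last) ∩ φ̂ (block D' first) ≡ ι̂ G
  junction = ⊆-antisym ⊆ι̂G ⊇ι̂G
    where
    ⊆ι̂G : ι̂ (block D last) ∩ φ̂ (block D' first) ⊆ ι̂ G
    ⊆ι̂G z∈ with ∈ι̂∩φ̂⇒∈φ̂G' {B = block D last} {A = block D' first} (x∈p∩q⇒x∈p z∈) (x∈p∩q⇒x∈q z∈)
    ... | y , _ , y∈G' , refl with φ[G']⊆ι[G] y∈G'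
    ...   | x , x∈G , φy≡ιx = subst (_∈ ι̂ G) (sym φy≡ιx) (∈-image⁺ ι G x∈G)
    ⊇ι̂G : ι̂ G ⊆ ι̂ (block D last) ∩ φ̂ (block D' first)
    ⊇ι̂G z∈ with ∈-image⁻ ι G z∈
    ... | x , x∈G , refl with ι[G]⊆φ[G'] x∈G
    ...   | y , y∈G' , φy≡ιx = x∈p∧x∈q⇒x∈p∩q (∈-image⁺ ι (block D last) (G⊆last x∈G))
                                       (subst (_∈ φ̂ (block D' first)) φy≡ιx (∈-image⁺ φ _ (G'⊆first y∈G')))

  at-blocks*-last : at blocks* (toℕ last) ≡ ι̂ (block D last)
  at-blocks*-last = trans (at-blocks*-ι̂ (subst (toℕ last <_) 1+last≡b ≤-refl)) (cong ι̂ (at-tabulate (block D) last))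

  at-blocks*-b : at blocks* b ≡ φ̂ (block D' first)
  at-blocks*-b = begin
    at blocks* b              ≡⟨ cong (at blocks*) (+-identityʳ b) ⟨
    at blocks* (b + 0)        ≡⟨ at-blocks*-glued 0 ⟩
    at (glued b' 0) 0         ≡⟨ head-glued b' 0<b' ⟩
    φ̂ (at blocks' 0)          ≡⟨ cong φ̂ (at-blocks' first first≡0) ⟩
    φ̂ (block D' first)        ∎
    where
    open ≡-Reasoning
    head-glued : ∀ r → 0 < r → at (glued r 0) 0 ≡ φ̂ (at blocks' 0)
    head-glued (suc r) _ = refl

  blocks*-Linked : Linked (Meet m) blocks*
  blocks*-Linked = at⇒Linked blocks* meet
    where
    meet : ∀ i → suc i < length blocks* → Meet m (at blocks* i) (at blocks* (suc i))
    meet i 1+i< with <-cmp (suc i) b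
    ... | tri< 1+i<b _ _ =
      subst₂ (Meet m) (sym (at-blocks*-ι̂ (<⇒≤ 1+i<b))) (sym (at-blocks*-ι̂ 1+i<b))
             (trans (∣image-∩∣ ι-injective (at blocks i) (at blocks (suc i))) (Meet-at-blocks 1+i<b))
    ... | tri≈ _ 1+i≡b _ =
      subst₂ (Meet m) (sym (trans (cong (at blocks*) (suc-injective (trans 1+i≡b (sym 1+last≡b)))) at-blocks*-last))
                      (sym (trans (cong (at blocks*) 1+i≡b) at-blocks*-b))
             (trans (cong ∣_∣ junction) (trans (∣image∣ ι-injective G) ∣G∣≡m))
    ... | tri> _ _ b<1+i with m≤n⇒∃[o]m+o≡n (≤-pred b<1+i)
    ...   | d , refl =
      subst₂ (Meet m) (sym (at-blocks*-glued d)) (sym (trans (cong (at blocks*) (sym (+-suc b d))) (at-blocks*-glued (suc d))))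
             (Linked⇒at (glued-Linked b' 0 ≤-refl)
                (+-cancelˡ-< b _ _ (subst (b + suc d <_) length-blocks* (subst (_< length blocks*) (sym (+-suc b d)) 1+i<))))

  φ̂block∈glued : ∀ r t₀ t → t₀ ≤ t → t < t₀ + r → φ̂ (at blocks' t) ∈ˡ glued r t₀
  φ̂block∈glued zero t₀ t t₀≤t t< = ⊥-elim (<-irrefl refl (≤-trans (s≤s t₀≤t) (≤-trans t< (≤-reflexive (+-identityʳ t₀)))))
  φ̂block∈glued (suc r) t₀ t t₀≤t t< with m≤n⇒m<n∨m≡n t₀≤t
  ... | inj₂ refl = here refl
  ... | inj₁ t₀<t = there (∈-++⁺ʳ (spokes (lookupKey (suc t₀) L'))
                            (φ̂block∈glued r (suc t₀) t t₀<t (subst (t <_) (+-suc t₀ r) t<)))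

  spoke∈glued : ∀ r t₀ t {S} → lookupKey (suc t) L' ≡ just S → t₀ ≤ t → t < t₀ + r →
                ∀ {x} → x ∈ˡ points∉G → spoke S x ∈ˡ glued r t₀
  spoke∈glued zero t₀ t _ t₀≤t t< _ = ⊥-elim (<-irrefl refl (≤-trans (s≤s t₀≤t) (≤-trans t< (≤-reflexive (+-identityʳ t₀)))))
  spoke∈glued (suc r) t₀ t {S} lookup≡ t₀≤t t< {x} x∈ with m≤n⇒m<n∨m≡n t₀≤t
  ... | inj₂ refl = there (∈-++⁺ˡ (subst (λ s → spoke S x ∈ˡ spokes s) (sym lookup≡) (∈-map⁺ (spoke S) x∈)))
  ... | inj₁ t₀<t = there (∈-++⁺ʳ (spokes (lookupKey (suc t₀) L'))
                            (spoke∈glued r (suc t₀) t lookup≡ t₀<t (subst (t <_) (+-suc t₀ r) t<) x∈))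

  Covered : Fin N → Fin N → Set
  Covered z₁ z₂ = ∃[ B ] B ∈ˡ blocks* × z₁ ∈ B × z₂ ∈ B

  Covered-sym : ∀ {z₁ z₂} → Covered z₁ z₂ → Covered z₂ z₁
  Covered-sym (B , B∈ , z₁∈B , z₂∈B) = B , B∈ , z₂∈B , z₁∈B

  Covered-ιι : ∀ x₁ x₂ → x₁ ≢ x₂ → Covered (ι x₁) (ι x₂)
  Covered-ιι x₁ x₂ x₁≢x₂ with covers D x₁ x₂ x₁≢x₂
  ... | j , x₁∈ , x₂∈ = ι̂ (block D j) , ∈-++⁺ˡ (∈-map⁺ ι̂ (∈-tabulate⁺ j)) ,
                        ∈-image⁺ ι _ x₁∈ , ∈-image⁺ ι _ x₂∈

  Covered-φφ : ∀ y₁ y₂ → y₁ ≢ y₂ → Covered (φ y₁) (φ y₂)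
  Covered-φφ y₁ y₂ y₁≢y₂ with covers D' y₁ y₂ y₁≢y₂
  ... | j , y₁∈ , y₂∈ = φ̂ (block D' j) ,
    ∈-++⁺ʳ (map ι̂ blocks) (subst (_∈ˡ glued b' 0) (cong φ̂ (at-tabulate (block D') j))
                                 (φ̂block∈glued b' 0 (toℕ j) z≤n (Fin.toℕ<n j))) ,
    ∈-image⁺ φ _ y₁∈ , ∈-image⁺ φ _ y₂∈

  ∉G'⇒inner : ∀ {y} → y ∉ G' → ∃[ t ] ∃[ S ] (suc t , S) ∈ˡ L' × y ∈ S
  ∉G'⇒inner {y} y∉G' with find (E'.cover y)
  ... | (zero , S) , ∈L' , y∈S = ⊥-elim (y∉G' (subst (y ∈_) (Keys-unique⇒≡ E'.distinct ∈L' 0,G'∈L') y∈S))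
  ... | (suc t , S) , ∈L' , y∈S = t , S , ∈L' , y∈S

  Covered-spoke : ∀ x y → x ∉ G → y ∉ G' → Covered (ι x) (φ y)
  Covered-spoke x y x∉G y∉G' with ∉G'⇒inner y∉G'
  ... | t , S , ∈L' , y∈S = spoke S x ,
    ∈-++⁺ʳ (map ι̂ blocks) (spoke∈glued b' 0 t (∈⇒lookupKey E'.distinct ∈L') z≤n (InnerEntry.t<b' (innerEntry ∈L'))
                                       (∈-elements⁺ (∁ G) (x∉p⇒x∈∁p x∉G))) ,
    x∈q⇒x∈p∪q (x∈⁅x⁆ (ι x)) , x∈p⇒x∈p∪q (∈-image⁺ φ S y∈S)

  Covered-ιφ : ∀ x y → y ∉ G' → ι x ≢ φ y → Covered (ι x) (φ y)
  Covered-ιφ x y y∉G' ιx≢φy with x ∈? G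
  ... | no x∉G  = Covered-spoke x y x∉G y∉G'
  ... | yes x∈G with ι[G]⊆φ[G'] x∈G
  ...   | y₀ , _ , φy₀≡ιx = subst (λ z → Covered z (φ y)) φy₀≡ιx (Covered-φφ y₀ y (λ { refl → ιx≢φy (sym φy₀≡ιx) }))

  covered : ∀ z₁ z₂ → z₁ ≢ z₂ → Covered z₁ z₂
  covered z₁ z₂ z₁≢z₂ with ι-or-φ z₁ | ι-or-φ z₂
  ... | inj₁ (x₁ , refl)     | inj₁ (x₂ , refl)     = Covered-ιι x₁ x₂ (λ { refl → z₁≢z₂ refl })
  ... | inj₂ (y₁ , _ , refl) | inj₂ (y₂ , _ , refl) = Covered-φφ y₁ y₂ (λ { refl → z₁≢z₂ refl })
  ... | inj₁ (x , refl)      | inj₂ (y , y∉G' , refl) = Covered-ιφ x y y∉G' z₁≢z₂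
  ... | inj₂ (y , y∉G' , refl) | inj₁ (x , refl)    = Covered-sym (Covered-ιφ x y y∉G' (z₁≢z₂ ∘ sym))

  blocks*-sizes : All (λ B → ∣ B ∣ ≡ suc m) blocks*
  blocks*-sizes = All.++⁺ (All.map⁺ (All.tabulate⁺ λ j → trans (∣image∣ ι-injective (block D j)) (blockSize D j)))
                          (glued-sizes b' 0 ≤-refl)

  innerCount : ℕ → ℕ → ℕ
  innerCount = sumFrom (λ t → isJust (lookupKey (suc t) L'))

  length-spokes : ∀ s → length (spokes s) ≡ length points∉G * isJust s
  length-spokes nothing  = sym (*-zeroʳ (length points∉G))
  length-spokes (just S) = trans (List.length-map (spoke S) points∉G) (sym (*-identityʳ (length points∉G)))

  length-glued : ∀ r t → length (glued r t) ≡ r + length points∉G * innerCount t r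
  length-glued zero    t = sym (*-zeroʳ (length points∉G))
  length-glued (suc r) t = cong suc (begin
    length (spokes s ++ glued r (suc t))                           ≡⟨ List.length-++ (spokes s) ⟩
    length (spokes s) + length (glued r (suc t))                   ≡⟨ cong₂ _+_ (length-spokes s) (length-glued r (suc t)) ⟩
    p * isJust s + (r + p * innerCount (suc t) r)                  ≡⟨ regroup p (isJust s) r (innerCount (suc t) r) ⟩
    r + p * (isJust s + innerCount (suc t) r)                      ∎)
    where
    open ≡-Reasoning
    s = lookupKey (suc t) L'
    p = length points∉G
    regroup : ∀ p i r c → p * i + (r + p * c) ≡ r + p * (i + c)
    regroup = solve-∀

  1+innerCount≡∣L'∣ : suc (innerCount 0 b') ≡ length L'
  1+innerCount≡∣L'∣ = begin
    suc (innerCount 0 b')                                          ≡⟨ cong (_+ innerCount 0 b') (cong isJust (∈⇒lookupKey E'.distinct 0,G'∈L')) ⟨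
    isJust (lookupKey 0 L') + innerCount 0 b'                       ≡⟨ cong (isJust (lookupKey 0 L') +_) (sumFrom-suc (λ j → isJust (lookupKey j L')) 0 b') ⟨
    sumFrom (λ j → isJust (lookupKey j L')) 0 (suc b')             ≡⟨ sumFrom-isJust-lookupKey L' (suc b') E'.distinct
                                                                        (All.map (s≤s ∘ Unchanged⇒≤ {D = D'}) E'.unchanged) ⟩
    length L'                                                      ∎
    where open ≡-Reasoning

  m*innerCount≡v'∸m : m * innerCount 0 b' ≡ v' ∸ m
  m*innerCount≡v'∸m = begin
    m * innerCount 0 b'                   ≡⟨ m+n∸m≡n m (m * innerCount 0 b') ⟨
    m + m * innerCount 0 b' ∸ m           ≡⟨ cong (_∸ m) (*-suc m (innerCount 0 b')) ⟨
    m * suc (innerCount 0 b') ∸ m         ≡⟨ cong (λ c → m * c ∸ m) 1+innerCount≡∣L'∣ ⟩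
    m * length L' ∸ m                     ≡⟨ cong (_∸ m) (trans (*-comm m (length L')) E'.count) ⟩
    v' ∸ m                                ∎
    where open ≡-Reasoning

  length-points∉G : length points∉G ≡ v ∸ m
  length-points∉G = trans (length-elements (∁ G)) (trans (∣∁p∣≡n∸∣p∣ G) (cong (v ∸_) ∣G∣≡m))

  m*length-blocks* : m * length blocks* ≡ m * (b + b') + (v ∸ m) * (v' ∸ m)
  m*length-blocks* = begin
    m * length blocks*                                   ≡⟨ cong (m *_) (trans length-blocks* (cong (b +_) (length-glued b' 0))) ⟩
    m * (b + (b' + length points∉G * innerCount 0 b'))   ≡⟨ cong (λ p → m * (b + (b' + p * innerCount 0 b'))) length-points∉G ⟩
    m * (b + (b' + (v ∸ m) * innerCount 0 b'))           ≡⟨ regroup m b b' (v ∸ m) (innerCount 0 b') ⟩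
    m * (b + b') + (v ∸ m) * (m * innerCount 0 b')       ≡⟨ cong (λ c → m * (b + b') + (v ∸ m) * c) m*innerCount≡v'∸m ⟩
    m * (b + b') + (v ∸ m) * (v' ∸ m)                    ∎
    where
    open ≡-Reasoning
    regroup : ∀ m b b' a c → m * (b + (b' + a * c)) ≡ m * (b + b') + a * (m * c)
    regroup = solve-∀

  x₁,points∉G : ∃[ x₁ ] ∃[ xs ] points∉G ≡ x₁ ∷ xs
  x₁,points∉G with points∉G in points≡
  ... | x₁ ∷ xs = x₁ , xs , refl
  ... | [] = ⊥-elim (<-irrefl (trans (sym (cong length points≡)) length-points∉G) (m<n⇒0<n∸m m<v))
    where
    m<v : m < v
    m<v = subst (_≤ v) (blockSize D last) (∣p∣≤n (block D last))

  x₁ : Fin v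
  x₁ = proj₁ x₁,points∉G

  x₁∉G : x₁ ∉ G
  x₁∉G = ∈points∉G⇒∉G (subst (x₁ ∈ˡ_) (sym (proj₂ (proj₂ x₁,points∉G))) (here refl))

  offset : ℕ → ℕ
  offset t = length (glued t 0)

  glued-at-inner : ∀ t S → t < b' → lookupKey (suc t) L' ≡ just S →
                   ∃[ rest ] glued b' 0 ≡ glued t 0 ++ (φ̂ (at blocks' t) ∷ spoke S x₁ ∷ rest)
  glued-at-inner t S t<b' lookup≡ with m≤n⇒∃[o]m+o≡n t<b'
  ... | o , 1+t+o≡b' = map (spoke S) (proj₁ (proj₂ x₁,points∉G)) ++ glued o (suc t) , (begin
    glued b' 0                                                            ≡⟨ cong (λ c → glued c 0) (trans (+-suc t o) 1+t+o≡b') ⟨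
    glued (t + suc o) 0                                                   ≡⟨ glued-+ t (suc o) 0 ⟩
    glued t 0 ++ (φ̂ (at blocks' t) ∷ (spokes (lookupKey (suc t) L') ++ glued o (suc t)))
      ≡⟨ cong (λ s → glued t 0 ++ (φ̂ (at blocks' t) ∷ (spokes s ++ glued o (suc t)))) lookup≡ ⟩
    glued t 0 ++ (φ̂ (at blocks' t) ∷ (map (spoke S) points∉G ++ glued o (suc t)))
      ≡⟨ cong (λ xs → glued t 0 ++ (φ̂ (at blocks' t) ∷ (map (spoke S) xs ++ glued o (suc t)))) (proj₂ (proj₂ x₁,points∉G)) ⟩
    _                                                                     ∎)
    where open ≡-Reasoning

  offset-< : ∀ {t₁ t₂} → t₁ < t₂ → offset t₁ < offset t₂
  offset-< {t₁} (s≤s t₁≤t₂) with m≤n⇒∃[o]m+o≡n t₁≤t₂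
  ... | o , refl = begin-strict
    offset t₁                                      <⟨ m<m+n (offset t₁) (s≤s z≤n) ⟩
    offset t₁ + length (glued (suc o) t₁)          ≡⟨ List.length-++ (glued t₁ 0) ⟨
    length (glued t₁ 0 ++ glued (suc o) (0 + t₁))  ≡⟨ cong length (glued-+ t₁ (suc o) 0) ⟨
    length (glued (t₁ + suc o) 0)                  ≡⟨ cong offset (+-suc t₁ o) ⟩
    offset (suc t₁ + o)                            ∎
    where open ≤-Reasoning

  offset-injective : ∀ {t₁ t₂} → offset t₁ ≡ offset t₂ → t₁ ≡ t₂
  offset-injective {t₁} {t₂} eq with <-cmp t₁ t₂
  ... | tri< t₁<t₂ _ _ = ⊥-elim (<-irrefl eq (offset-< t₁<t₂))
  ... | tri≈ _ t₁≡t₂ _ = t₁≡t₂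
  ... | tri> _ _ t₂<t₁ = ⊥-elim (<-irrefl (sym eq) (offset-< t₂<t₁))

  -- innerIndex (t + 1) is the index of the unchanged subset φ̂ U'_(t+1) of the glued design;
  -- innerIndex 0 is a junk value, as U'_0 is the one member of the outer expansion set not lifted.
  innerIndex : ℕ → ℕ
  innerIndex zero    = 0
  innerIndex (suc t) = b + suc (offset t)

  innerIndex-injective : ∀ {i j} → innerIndex i ≡ innerIndex j → i ≡ j
  innerIndex-injective {zero}  {zero}  _  = refl
  innerIndex-injective {zero}  {suc j} eq = ⊥-elim (0≢1+n (trans eq (+-suc b (offset j))))
  innerIndex-injective {suc i} {zero}  eq = ⊥-elim (0≢1+n (trans (sym eq) (+-suc b (offset i))))
  innerIndex-injective {suc i} {suc j} eq = cong suc (offset-injective (suc-injective (+-cancelˡ-≡ b _ _ eq)))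

  b<∣blocks*∣ : b < length blocks*
  b<∣blocks*∣ = subst (b <_) (sym length-blocks*) (b<b+∣glued∣ b' 0<b')
    where
    b<b+∣glued∣ : ∀ r → 0 < r → b < b + length (glued r 0)
    b<b+∣glued∣ (suc r) _ = subst (b <_) (sym (+-suc b _)) (s≤s (m≤m+n b _))

  module Design* (b* : ℕ) (∣blocks*∣≡b* : length blocks* ≡ b*) where
    D* : SCCD N (suc m) b*
    D* = sccdFromList blocks* ∣blocks*∣≡b* blocks*-sizes blocks*-Linked covered

    index : ∀ {p} → p < length blocks* → Fin b*
    index {p} p< = fromℕ< (subst (p <_) ∣blocks*∣≡b* p<)

    toℕ-index : ∀ {p} (p< : p < length blocks*) → toℕ (index p<) ≡ p
    toℕ-index {p} p< = Fin.toℕ-fromℕ< (subst (p <_) ∣blocks*∣≡b* p<)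

    block-index : ∀ {p} (p< : p < length blocks*) → block D* (index p<) ≡ at blocks* p
    block-index p< = cong (at blocks*) (toℕ-index p<)

    Unchanged-ι̂ : ∀ {i S} → Unchanged D i S → (i ≡ b → S ≡ G) → Unchanged D* i (ι̂ S)
    Unchanged-ι̂ {S = S} (inj₁ (refl , j , j≡0 , S⊆ , ∣S∣)) _ =
      inj₁ (refl , index 0< , toℕ-index 0< ,
            subst (ι̂ S ⊆_) (sym (trans (block-index 0<) (trans (at-blocks*-ι̂ 0<b)
                               (cong ι̂ (trans (cong (at blocks) (sym j≡0)) (at-tabulate (block D) j))))))
                  (image-mono ι S⊆) ,
            trans (∣image∣ ι-injective S) ∣S∣)
      where
      0<b : 0 < b
      0<b = subst (_< b) j≡0 (Fin.toℕ<n j)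
      0< : 0 < length blocks*
      0< = <-trans 0<b b<∣blocks*∣
    Unchanged-ι̂ (inj₂ (inj₁ (refl , _))) S≡G with S≡G refl
    ... | refl = inj₂ (inj₂ (index last< , index b<∣blocks*∣ ,
                   trans (toℕ-index b<∣blocks*∣) (trans (sym 1+last≡b) (cong suc (sym (toℕ-index last<)))) ,
                   sym (toℕ-index b<∣blocks*∣) ,
                   sym (trans (cong₂ _∩_ (trans (block-index last<) at-blocks*-last)
                                         (trans (block-index b<∣blocks*∣) at-blocks*-b))
                              junction)))
      where last< = <-trans (subst (toℕ last <_) 1+last≡b ≤-refl) b<∣blocks*∣
    Unchanged-ι̂ (inj₂ (inj₂ (j , j′ , j′≡1+j , refl , refl))) _ =
      inj₂ (inj₂ (index j< , index j′< ,
         trans (toℕ-index j′<) (trans j′≡1+j (cong suc (sym (toℕ-index j<)))) , sym (toℕ-index j′<) ,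
         trans (image-∩ ι-injective (block D j) (block D j′))
               (sym (cong₂ _∩_ (at-block j j<) (at-block j′ j′<)))))
      where
      j<  = <-trans (Fin.toℕ<n j) b<∣blocks*∣
      j′< = <-trans (Fin.toℕ<n j′) b<∣blocks*∣
      at-block : ∀ i (i< : toℕ i < length blocks*) → block D* (index i<) ≡ ι̂ (block D i)
      at-block i i< = trans (block-index i<) (trans (at-blocks*-ι̂ (Fin.toℕ<n i)) (cong ι̂ (at-tabulate (block D) i)))

    Unchanged-φ̂ : ∀ {t S} → (suc t , S) ∈ˡ L' → Unchanged D* (innerIndex (suc t)) (φ̂ S)
    Unchanged-φ̂ {t} {S} ∈L' with glued-at-inner t S (InnerEntry.t<b' (innerEntry ∈L')) (∈⇒lookupKey E'.distinct ∈L')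
    ... | rest , glued≡ = inj₂ (inj₂ (index left< , index right< ,
           trans (toℕ-index right<) (trans (+-suc b (offset t)) (cong suc (sym (toℕ-index left<)))) ,
           sym (toℕ-index right<) ,
           sym (begin
             block D* (index left<) ∩ block D* (index right<)
               ≡⟨ cong₂ _∩_ (trans (block-index left<) at-left) (trans (block-index right<) at-right) ⟩
             φ̂ (at blocks' t) ∩ spoke S x₁
               ≡⟨ ∩-comm (φ̂ (at blocks' t)) (spoke S x₁) ⟩
             spoke S x₁ ∩ φ̂ (at blocks' t)
               ≡⟨ ∪⁅x⁆∩-cancel (φ̂ S) (φ̂ (at blocks' t)) (ι x₁) (image-mono φ (InnerEntry.S⊆left (innerEntry ∈L')))
                                (ι∉φ̂ (at blocks' t) x₁∉G) ⟩
             φ̂ S ∎)))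
      where
      open ≡-Reasoning
      ∣blocks*∣≡ : length blocks* ≡ b + (offset t + suc (suc (length rest)))
      ∣blocks*∣≡ = trans length-blocks* (cong (b +_) (trans (cong length glued≡) (List.length-++ (glued t 0))))
      left< : b + offset t < length blocks*
      left< = subst (b + offset t <_) (sym ∣blocks*∣≡) (+-monoʳ-< b (m<m+n (offset t) (s≤s z≤n)))
      right< : b + suc (offset t) < length blocks*
      right< = subst (b + suc (offset t) <_) (sym ∣blocks*∣≡)
                 (+-monoʳ-< b (subst (suc (offset t) <_) (sym (+-suc (offset t) _)) (s≤s (m<m+n (offset t) (s≤s z≤n)))))
      at-left : at blocks* (b + offset t) ≡ φ̂ (at blocks' t)
      at-left = begin
        at blocks* (b + offset t)            ≡⟨ at-blocks*-glued (offset t) ⟩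
        at (glued b' 0) (offset t)           ≡⟨ cong (λ Bs → at Bs (offset t)) glued≡ ⟩
        at (glued t 0 ++ _) (offset t)       ≡⟨ cong (at (glued t 0 ++ _)) (+-identityʳ (offset t)) ⟨
        at (glued t 0 ++ _) (offset t + 0)   ≡⟨ at-++ʳ (glued t 0) _ 0 ⟩
        φ̂ (at blocks' t)                     ∎
      at-right : at blocks* (b + suc (offset t)) ≡ spoke S x₁
      at-right = begin
        at blocks* (b + suc (offset t))      ≡⟨ at-blocks*-glued (suc (offset t)) ⟩
        at (glued b' 0) (suc (offset t))     ≡⟨ cong (λ Bs → at Bs (suc (offset t))) glued≡ ⟩
        at (glued t 0 ++ _) (suc (offset t)) ≡⟨ cong (at (glued t 0 ++ _)) (+-comm (offset t) 1) ⟨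
        at (glued t 0 ++ _) (offset t + 1)   ≡⟨ at-++ʳ (glued t 0) _ 1 ⟩
        spoke S x₁                           ∎

    liftι : ℕ × Subset v → ℕ × Subset N
    liftι (i , S) = i , ι̂ S

    liftφ : ℕ × Subset v' → ℕ × Subset N
    liftφ (i , S) = innerIndex i , φ̂ S

    module _ (L : List (ℕ × Subset v)) (E : IsExpansionSet D L)
             (U_b≡G : ∀ {i S} → (i , S) ∈ˡ L → i ≡ b → S ≡ G) where
      private module E = IsExpansionSet E

      L* : List (ℕ × Subset N)
      L* = map liftι L ++ map liftφ (withoutKey0 L')

      L*-unchanged : All (λ p → Unchanged D* (proj₁ p) (proj₂ p)) L*
      L*-unchanged = All.++⁺
        (All.map⁺ (All.tabulate λ {p} p∈ → Unchanged-ι̂ (All.lookup E.unchanged p∈) (U_b≡G p∈)))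
        (All.map⁺ (All.tabulate λ {p} p∈ → unchanged-φ̂ (∈-withoutKey0⁻ {L = L'} p∈)))
        where
        unchanged-φ̂ : ∀ {p} → p ∈ˡ L' × ∃[ t ] proj₁ p ≡ suc t → Unchanged D* (proj₁ (liftφ p)) (proj₂ (liftφ p))
        unchanged-φ̂ (p∈ , t , refl) = Unchanged-φ̂ p∈

      keys-L* : map proj₁ L* ≡ map proj₁ L ++ map innerIndex (map proj₁ (withoutKey0 L'))
      keys-L* = trans (List.map-++ proj₁ (map liftι L) (map liftφ (withoutKey0 L')))
                      (cong₂ _++_ (sym (List.map-∘ L)) (trans (sym (List.map-∘ (withoutKey0 L'))) (List.map-∘ (withoutKey0 L'))))

      L*-distinct : Unique (map proj₁ L*)
      L*-distinct = subst Unique (sym keys-L*)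
        (Unique.++⁺ E.distinct (Unique.map⁺ innerIndex-injective (Keys-unique-withoutKey0 E'.distinct))
                    (λ (i∈L , i∈L') → <⇒≱ (b<innerIndex i∈L') (key≤b i∈L)))
        where
        key≤b : ∀ {i} → i ∈ˡ map proj₁ L → i ≤ b
        key≤b i∈ with ∈-map⁻ proj₁ i∈
        ... | _ , p∈ , refl = Unchanged⇒≤ {D = D} (All.lookup E.unchanged p∈)
        b<innerIndex : ∀ {i} → i ∈ˡ map innerIndex (map proj₁ (withoutKey0 L')) → b < i
        b<innerIndex i∈ with ∈-map⁻ innerIndex i∈
        ... | _ , j∈ , refl with ∈-map⁻ proj₁ j∈
        ...   | _ , p∈ , refl with ∈-withoutKey0⁻ {L = L'} p∈
        ...     | _ , t , key≡ = subst (λ c → b < innerIndex c) (sym key≡) (m<m+n b (s≤s z≤n))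

      L*-disjoint : AllPairs (λ p q → Empty (proj₂ p ∩ proj₂ q)) L*
      L*-disjoint = AllPairs.++⁺ (AllPairs.map⁺ (AllPairs.map (image-Empty ι-injective) E.disjoint))
                                 (AllPairs.map⁺ (AllPairs.map (image-Empty φ-injective) (AllPairs-withoutKey0 E'.disjoint)))
                                 (All.tabulate λ p∈ → All.tabulate λ q∈ → disjoint p∈ q∈)
        where
        disjoint : ∀ {p q} → p ∈ˡ map liftι L → q ∈ˡ map liftφ (withoutKey0 L') → Empty (proj₂ p ∩ proj₂ q)
        disjoint p∈ q∈ (z , z∈) with ∈-map⁻ liftι p∈ | ∈-map⁻ liftφ q∈
        ... | (_ , S) , _ , refl | (_ , S′) , q∈′ , refl with ∈-withoutKey0⁻ {L = L'} q∈′
        ...   | ∈L' , t , refl with ∈ι̂∩φ̂⇒∈φ̂G' {B = S} {A = S′} (x∈p∩q⇒x∈p z∈) (x∈p∩q⇒x∈q z∈)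
        ...     | y , y∈S′ , y∈G' , _ = inner∩G'-empty ∈L' (y , x∈p∧x∈q⇒x∈p∩q y∈S′ y∈G')

      L*-cover : ∀ z → Any (λ p → z ∈ proj₂ p) L*
      L*-cover z with ι-or-φ z
      ... | inj₁ (x , refl) = Any.++⁺ˡ (Any.map⁺ (Any.map (λ {p} → ∈-image⁺ ι (proj₂ p)) (E.cover x)))
      ... | inj₂ (y , y∉G' , refl) with ∉G'⇒inner y∉G'
      ...   | t , S , ∈L' , y∈S = lose (∈-++⁺ʳ (map liftι L) (∈-map⁺ liftφ (∈-withoutKey0⁺ ∈L'))) (∈-image⁺ φ S y∈S)

      L*-count : length L* * m ≡ N
      L*-count = begin
        length L* * m                                        ≡⟨ cong (_* m) (List.length-++ (map liftι L)) ⟩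
        (length (map liftι L) + length (map liftφ L'₊)) * m  ≡⟨ cong (_* m) (cong₂ _+_ (List.length-map liftι L) (List.length-map liftφ L'₊)) ⟩
        (length L + length L'₊) * m                          ≡⟨ *-distribʳ-+ m (length L) (length L'₊) ⟩
        length L * m + length L'₊ * m                        ≡⟨ cong₂ _+_ E.count inner-count ⟩
        v + (v' ∸ m)                                         ∎
        where
        open ≡-Reasoning
        L'₊ = withoutKey0 L'
        inner-count : length L'₊ * m ≡ v' ∸ m
        inner-count = begin
          length L'₊ * m                   ≡⟨ m+n∸m≡n m (length L'₊ * m) ⟨
          m + length L'₊ * m ∸ m           ≡⟨ cong (λ c → c * m ∸ m) (length-withoutKey0 E'.distinct 0,G'∈L') ⟩
          length L' * m ∸ m                ≡⟨ cong (_∸ m) E'.count ⟩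
          v' ∸ m                           ∎

      IsExpansionSet-L* : IsExpansionSet D* L*
      IsExpansionSet-L* = record
        { unchanged = L*-unchanged
        ; distinct  = L*-distinct
        ; count     = L*-count
        ; disjoint  = L*-disjoint
        ; cover     = L*-cover
        }

∣p∣≡suc⇒Nonempty : {c : ℕ} (p : Subset n) → ∣ p ∣ ≡ suc c → Nonempty p
∣p∣≡suc⇒Nonempty {n} p ∣p∣≡1+c with nonempty? p
... | yes nonempty = nonempty
... | no empty = ⊥-elim (0≢1+n (trans (sym (trans (cong ∣_∣ (Empty-unique empty)) (∣⊥∣≡0 n))) ∣p∣≡1+c))

record LastUnchangedChoice {v k b : ℕ} (D : SCCD v k b) : Set where
  field
    G        : Subset v
    last     : Fin b
    1+last≡b : suc (toℕ last) ≡ b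
    G⊆last   : G ⊆ block D last
    ∣G∣≡k∸1  : ∣ G ∣ ≡ k ∸ 1
    agreeing : ExpansionSet D → Σ (List (ℕ × Subset v)) λ L →
               IsExpansionSet D L × (∀ {i S} → (i , S) ∈ˡ L → i ≡ b → S ≡ G)

-- If some expansion set contains U_b, that U_b is chosen and that expansion set replaces every other one;
-- otherwise no expansion set has an entry with index b, and any (k-1)-subset of the last block will do.
lastUnchangedChoice : ∀ {v k b} → 2 ≤ k → 1 ≤ b → (D : SCCD v k b) → LastUnchangedChoice D
lastUnchangedChoice {v} {k} {b} 2≤k 1≤b D with expansionSetWithLast? D 2≤k
... | yes (L₀ , E₀ , last∈) with find last∈
...   | (i , S₀) , ∈L₀ , refl with All.lookup (IsExpansionSet.unchanged E₀) ∈L₀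
...     | inj₁ (b≡0 , _) = ⊥-elim (<-irrefl (sym b≡0) 1≤b)
...     | inj₂ (inj₂ (_ , j′ , _ , b≡j′ , _)) = ⊥-elim (<-irrefl (sym b≡j′) (Fin.toℕ<n j′))
...     | inj₂ (inj₁ (_ , j , 1+j≡b , S₀⊆ , ∣S₀∣)) = record
  { G = S₀ ; last = j ; 1+last≡b = 1+j≡b ; G⊆last = S₀⊆ ; ∣G∣≡k∸1 = ∣S₀∣
  ; agreeing = λ _ → L₀ , E₀ , λ { ∈L₀′ refl → Keys-unique⇒≡ (IsExpansionSet.distinct E₀) ∈L₀′ ∈L₀ }
  }
lastUnchangedChoice {v} {suc m} {suc b₀} 2≤k 1≤b D | no ¬withLast = record
  { G = block D last - x ; last = last ; 1+last≡b = cong suc (Fin.toℕ-fromℕ b₀) ; G⊆last = p─q⊆p (block D last) ⁅ x ⁆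
  ; ∣G∣≡k∸1 = suc-injective (trans (x∈p⇒∣p-x∣+1≡∣p∣ (block D last) x x∈last) (blockSize D last))
  ; agreeing = λ (L , E) → L , E , λ ∈L i≡b → ⊥-elim (¬withLast (L , E , lose ∈L i≡b))
  }
  where
  last : Fin (suc b₀)
  last = Fin.fromℕ b₀
  x,x∈last : Nonempty (block D last)
  x,x∈last = ∣p∣≡suc⇒Nonempty (block D last) (blockSize D last)
  x : Fin v
  x = proj₁ x,x∈last
  x∈last : x ∈ block D last
  x∈last = proj₂ x,x∈last

record ExpansionSetWithFirst (v' k b' : ℕ) : Set where
  field
    design   : SCCD v' k b'
    entries  : List (ℕ × Subset v')
    expands  : IsExpansionSet design entries
    U₀       : Subset v'
    0,U₀∈    : (0 , U₀) ∈ˡ entries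

-- An outer expansion set containing U_b becomes one containing U_0 after reversing the blocks.
expansionSetWithFirst : ∀ {v' k b'} (D' : SCCD v' k b') → OuterExpansionSet D' → ExpansionSetWithFirst v' k b'
expansionSetWithFirst {b' = b'} D' (L , E , outer∈) with find outer∈
... | (_ , S) , ∈L , inj₁ refl = record { design = D' ; entries = L ; expands = E ; U₀ = S ; 0,U₀∈ = ∈L }
... | (_ , S) , ∈L , inj₂ refl = record
  { design = reverse ; entries = map reverseIndex L ; expands = IsExpansionSet-reverse E ; U₀ = S
  ; 0,U₀∈ = subst (λ c → (c , S) ∈ˡ map reverseIndex L) (n∸n≡0 b') (∈-map⁺ reverseIndex ∈L)
  }
  where open Reverse D'

-- The excess

[a+b]C2 : ∀ a b → (a + b) C 2 ≡ a C 2 + b C 2 + a * b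
[a+b]C2 zero    b = sym (+-identityʳ (b C 2))
[a+b]C2 (suc a) b = begin
  suc (a + b) C 2                   ≡⟨ nCk+nC[k+1]≡[n+1]C[k+1] (a + b) 1 ⟨
  (a + b) C 1 + (a + b) C 2         ≡⟨ cong₂ _+_ (nC1≡n (a + b)) ([a+b]C2 a b) ⟩
  a + b + (a C 2 + b C 2 + a * b)   ≡⟨ regroup a b (a C 2) (b C 2) ⟩
  a + a C 2 + b C 2 + (b + a * b)   ≡⟨ cong (λ c → c + a C 2 + b C 2 + (b + a * b)) (nC1≡n a) ⟨
  a C 1 + a C 2 + b C 2 + (b + a * b) ≡⟨ cong (λ c → c + b C 2 + suc a * b) (nCk+nC[k+1]≡[n+1]C[k+1] a 1) ⟩
  suc a C 2 + b C 2 + suc a * b     ∎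
  where
  open ≡-Reasoning
  regroup : ∀ a b ca cb → a + b + (ca + cb + a * b) ≡ a + ca + cb + (b + a * b)
  regroup = solve-∀

-- The excess equation for v = a + m, v' = a' + m and v* = a + m + a', with the subtractions moved across.
excess-identity : ∀ m a a' b b' b* → m * b* ≡ m * (b + b') + a * a' →
  m * b* + m C 2 + (a + m) C 2 + (a' + m) C 2 ≡ m * b + m C 2 + (m * b' + m C 2) + (a + m + a') C 2
excess-identity m a a' b b' b* m*b*≡ = begin
  m * b* + m C 2 + (a + m) C 2 + (a' + m) C 2
    ≡⟨ cong₂ (λ c d → m * b* + m C 2 + c + d) ([a+b]C2 a m) ([a+b]C2 a' m) ⟩
  m * b* + m C 2 + (a C 2 + m C 2 + a * m) + (a' C 2 + m C 2 + a' * m)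
    ≡⟨ cong (λ c → c + m C 2 + (a C 2 + m C 2 + a * m) + (a' C 2 + m C 2 + a' * m)) m*b*≡ ⟩
  m * (b + b') + a * a' + m C 2 + (a C 2 + m C 2 + a * m) + (a' C 2 + m C 2 + a' * m)
    ≡⟨ regroup m a a' b b' (a C 2) (a' C 2) (m C 2) ⟩
  m * b + m C 2 + (m * b' + m C 2) + (a C 2 + m C 2 + a * m + a' C 2 + (a + m) * a')
    ≡⟨ cong (m * b + m C 2 + (m * b' + m C 2) +_) (cong (λ c → c + a' C 2 + (a + m) * a') ([a+b]C2 a m)) ⟨
  m * b + m C 2 + (m * b' + m C 2) + ((a + m) C 2 + a' C 2 + (a + m) * a')
    ≡⟨ cong (m * b + m C 2 + (m * b' + m C 2) +_) ([a+b]C2 (a + m) a') ⟨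
  m * b + m C 2 + (m * b' + m C 2) + (a + m + a') C 2 ∎
  where
  open ≡-Reasoning
  regroup : ∀ m a a' b b' ca ca' cm →
    m * (b + b') + a * a' + cm + (ca + cm + a * m) + (ca' + cm + a' * m)
      ≡ m * b + cm + (m * b' + cm) + (ca + cm + a * m + ca' + (a + m) * a')
  regroup = solve-∀

+p-+u≡[+q-+s]+[+r-+t] : ∀ p q r s t u → p + s + t ≡ q + r + u →
  ℤ.+ p ℤ.- ℤ.+ u ≡ (ℤ.+ q ℤ.- ℤ.+ s) ℤ.+ (ℤ.+ r ℤ.- ℤ.+ t)
+p-+u≡[+q-+s]+[+r-+t] p q r s t u p+s+t≡q+r+u = begin
  ℤ.+ p ℤ.- ℤ.+ u                                           ≡⟨ cancel (ℤ.+ p) (ℤ.+ s) (ℤ.+ t) (ℤ.+ u) ⟨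
  ℤ.+ p ℤ.+ ℤ.+ s ℤ.+ ℤ.+ t ℤ.- ℤ.+ u ℤ.- ℤ.+ s ℤ.- ℤ.+ t   ≡⟨ cong (λ z → z ℤ.- ℤ.+ u ℤ.- ℤ.+ s ℤ.- ℤ.+ t) lifted ⟩
  ℤ.+ q ℤ.+ ℤ.+ r ℤ.+ ℤ.+ u ℤ.- ℤ.+ u ℤ.- ℤ.+ s ℤ.- ℤ.+ t   ≡⟨ regroup (ℤ.+ q) (ℤ.+ r) (ℤ.+ s) (ℤ.+ t) (ℤ.+ u) ⟩
  (ℤ.+ q ℤ.- ℤ.+ s) ℤ.+ (ℤ.+ r ℤ.- ℤ.+ t)                   ∎
  where
  open ≡-Reasoning
  lifted : ℤ.+ p ℤ.+ ℤ.+ s ℤ.+ ℤ.+ t ≡ ℤ.+ q ℤ.+ ℤ.+ r ℤ.+ ℤ.+ u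
  lifted = begin
    ℤ.+ p ℤ.+ ℤ.+ s ℤ.+ ℤ.+ t   ≡⟨ cong (ℤ._+ ℤ.+ t) (ℤ.pos-+ p s) ⟨
    ℤ.+ (p + s) ℤ.+ ℤ.+ t       ≡⟨ ℤ.pos-+ (p + s) t ⟨
    ℤ.+ (p + s + t)             ≡⟨ cong ℤ.+_ p+s+t≡q+r+u ⟩
    ℤ.+ (q + r + u)             ≡⟨ ℤ.pos-+ (q + r) u ⟩
    ℤ.+ (q + r) ℤ.+ ℤ.+ u       ≡⟨ cong (ℤ._+ ℤ.+ u) (ℤ.pos-+ q r) ⟩
    ℤ.+ q ℤ.+ ℤ.+ r ℤ.+ ℤ.+ u   ∎
  cancel : ∀ P S T U → P ℤ.+ S ℤ.+ T ℤ.- U ℤ.- S ℤ.- T ≡ P ℤ.- U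
  cancel = ℤ-Solver.solve-∀
  regroup : ∀ Q R S T U → Q ℤ.+ R ℤ.+ U ℤ.- U ℤ.- S ℤ.- T ≡ (Q ℤ.- S) ℤ.+ (R ℤ.- T)
  regroup = ℤ-Solver.solve-∀

excess-split : ∀ m a a' b b' b* → m * b* ≡ m * (b + b') + a * a' →
  excess (a + m + a') (suc m) b* ≡ excess (a + m) (suc m) b ℤ.+ excess (a' + m) (suc m) b'
excess-split m a a' b b' b* m*b*≡ =
  +p-+u≡[+q-+s]+[+r-+t] (m * b* + m C 2) (m * b + m C 2) (m * b' + m C 2) ((a + m) C 2) ((a' + m) C 2) ((a + m + a') C 2)
    (excess-identity m a a' b b' b* m*b*≡)

excess-glue : ∀ m v v' b b' b* → m ≤ v → m ≤ v' → m * b* ≡ m * (b + b') + (v ∸ m) * (v' ∸ m) →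
  excess (v + (v' ∸ m)) (suc m) b* ≡ excess v (suc m) b ℤ.+ excess v' (suc m) b'
excess-glue m v v' b b' b* m≤v m≤v' m*b*≡ = begin
  excess (v + (v' ∸ m)) (suc m) b*                                ≡⟨ cong (λ n → excess (n + (v' ∸ m)) (suc m) b*) (m∸n+n≡m m≤v) ⟨
  excess (v ∸ m + m + (v' ∸ m)) (suc m) b*                        ≡⟨ excess-split m (v ∸ m) (v' ∸ m) b b' b* m*b*≡ ⟩
  excess (v ∸ m + m) (suc m) b ℤ.+ excess (v' ∸ m + m) (suc m) b' ≡⟨ cong₂ (λ n n' → excess n (suc m) b ℤ.+ excess n' (suc m) b')
                                                                             (m∸n+n≡m m≤v) (m∸n+n≡m m≤v') ⟩
  excess v (suc m) b ℤ.+ excess v' (suc m) b'                     ∎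
  where open ≡-Reasoning

size≤points : ∀ {v k b} (D : SCCD v k b) → Fin b → k ≤ v
size≤points D j = subst (_≤ _) (blockSize D j) (∣p∣≤n (block D j))

theorem3 : ∀ (v v' k b b' : ℕ) → 2 ≤ k → 1 ≤ b →
    (D : SCCD v k b) → (D' : SCCD v' k b') → OuterExpansionSet D' →
    ∀ (bstar : ℕ) →
    (k ∸ 1) * bstar ≡ (k ∸ 1) * (b + b') + (suc v ∸ k) * (suc v' ∸ k) →
    Σ (SCCD (suc (v + v') ∸ k) k bstar) λ Dstar →
      (excess (suc (v + v') ∸ k) k bstar ≡ excess v k b ℤ.+ excess v' k b')
      × (ExpansionSet D → ExpansionSet Dstar)
theorem3 v v' (suc m) b b' 2≤k@(s≤s 1≤m) 1≤b D D' outer b* m*b*≡ =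
  subst (λ n → Σ (SCCD n (suc m) b*) λ D* →
                 (excess n (suc m) b* ≡ excess v (suc m) b ℤ.+ excess v' (suc m) b') × (ExpansionSet D → ExpansionSet D*))
        (sym (+-∸-assoc v m≤v'))
        (D* , excess-glue m v v' b b' b* m≤v m≤v' m*b*≡ , expansionSet*)
  where
  open LastUnchangedChoice (lastUnchangedChoice 2≤k 1≤b D)
  open ExpansionSetWithFirst (expansionSetWithFirst D' outer)
  open Glue v v' m b b' D design G last 1+last≡b G⊆last ∣G∣≡k∸1 entries expands U₀ 0,U₀∈
  open Design* b* (*-cancelˡ-≡ (length blocks*) b* m {{>-nonZero 1≤m}} (trans m*length-blocks* (sym m*b*≡)))
  m≤v : m ≤ v
  m≤v = ≤-trans (n≤1+n m) (size≤points D last)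
  m≤v' : m ≤ v'
  m≤v' = ≤-trans (n≤1+n m) (size≤points design first)
  expansionSet* : ExpansionSet D → ExpansionSet D*
  expansionSet* E = let L , E′ , U_b≡G = agreeing E in L* L E′ U_b≡G , IsExpansionSet-L* L E′ U_b≡G
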